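{- Let $k\in\mathbb{Z}^+$ and let $n\geq 2k+1$. Then $$\frac1{n!}\sum_{\pi\in\mathcal{S}_n}\operatorname{des}(\pi^k)=\frac{n-1}2-\frac{\tau^2(k)-\tau(k)-\tau_{\mathrm{o}}(k)+\sigma(k)}{2n}.$$
   Context: $\mathcal{S}_n$ is the symmetric group on $[n]=\{1,\dots,n\}$. For $\pi\in\mathcal{S}_n$, a descent of $\pi$ is an index $i\in[n-1]$ with $\pi(i)>\pi(i+1)$, and $\operatorname{des}(\pi)$ is the number of descents. For $k\in\mathbb{Z}^+$, $\tau(k)$ is the number of positive divisors of $k$, $\sigma(k)$ is the sum of the positive divisors of $k$, $\nu_2(k)$ is the exponent of $2$ in the prime factorization of $k$, and $\tau_{\mathrm{o}}(k)=\tau(k/2^{\nu_2(k)})$ is the number of odd positive divisors of $k$. -}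

module Defs where

open import Data.Nat using (ℕ; zero; suc; _+_; _*_; _∸_; _≤_)
open import Data.Nat.Divisibility using (_∣?_)
open import Data.Bool using (Bool; true; false; _∧_; not; if_then_else_)
open import Data.Fin using (Fin; toℕ)
open import Data.Fin.Properties using (_≟_; _<?_)
open import Data.List using (List; []; _∷_; map; concatMap; filter; filterᵇ; length; upTo; allFin)
open import Data.Nat.ListAction using (sum)
open import Data.Vec using (Vec; lookup; tabulate; toList)
import Data.Vec
open import Function using (_∘_)
open import Data.Nat.Base using (_%_)
import Data.Nat.Properties as ℕP
open import Relation.Nullary using (does)

-- Permutations of [n] in one-line notation: π is the vector (π(1),…,π(n)),
-- entries in Fin n (i.e. {0,…,n-1} standing for {1,…,n}).

allVecs : (n m : ℕ) → List (Vec (Fin n) m)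
allVecs n zero    = Data.Vec.[] ∷ []
allVecs n (suc m) = concatMap (λ v → map (Data.Vec._∷ v) (allFin n)) (allVecs n m)

-- injectivity of i ↦ lookup v i (for a map Fin n → Fin n this means bijectivity)
injective? : {n : ℕ} → Vec (Fin n) n → Bool
injective? {n} v =
  allB (λ i → allB (λ j → does (i ≟ j) ∨' not (does (lookup v i ≟ lookup v j))) (allFin n)) (allFin n)
  where
    allB : {A : Set} → (A → Bool) → List A → Bool
    allB p []       = true
    allB p (x ∷ xs) = p x ∧ allB p xs
    _∨'_ : Bool → Bool → Bool
    true  ∨' _ = true
    false ∨' b = b

Sym : (n : ℕ) → List (Vec (Fin n) n)
Sym n = filterᵇ injective? (allVecs n n)

iter : {A : Set} → (A → A) → ℕ → A → A
iter f zero    x = x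
iter f (suc k) x = f (iter f k x)

power : {n : ℕ} → Vec (Fin n) n → ℕ → Vec (Fin n) n
power v k = tabulate (iter (lookup v) k)

desList : {n : ℕ} → List (Fin n) → ℕ
desList []             = 0
desList (x ∷ [])       = 0
desList (x ∷ y ∷ rest) = (if does (y <? x) then 1 else 0) + desList (y ∷ rest)

des : {n : ℕ} → Vec (Fin n) n → ℕ
des v = desList (toList v)

divisors : ℕ → List ℕ
divisors k = filter (_∣? k) (map suc (upTo k))

τ : ℕ → ℕ
τ k = length (divisors k)

σ : ℕ → ℕ
σ k = sum (divisors k)

-- number of odd positive divisors of k  (= τ(k / 2^{ν₂(k)}))
τₒ : ℕ → ℕ
τₒ k = length (filter (λ d → d % 2 ℕP.≟ 1) (divisors k))

desPowSum : (n k : ℕ) → ℕ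
desPowSum n k = sum (map (λ π → des (power π k)) (Sym n))

-- By linearity Σ_π des(π^k) = Σ_i D_i, where D_i counts the π with π^k(i+1) < π^k(i).
-- Conjugating by the transposition (i i+1) turns these into the π with π^k(i) < π^k(i+1), except when π^k
-- fixes both points (A of them) or swaps them (B of them), so 2 D_i = n! − A + B.
-- Counting permutations with prescribed values ((n − #constraints)! of them) shows that a point lies on a
-- cycle of any given length for (n−1)! permutations, so π^k fixes it for τ(k) (n−1)!.  For 2k ≤ n, splitting
-- by the cycle of the first point gives A = (n−2)! (σ(k) + τ(k)² − τ(k)), and symmetry in the second point
-- gives (n−1) B = (τ(2k) − τ(k)) (n−1)!, where τ(2k) − τ(k) = τₒ(k) by the pairing d ↦ 2k/d.
module Submission where

open import Defs
open import Data.Nat using (ℕ; _+_; _*_; _∸_; _≤_; _!)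
open import Relation.Binary.PropositionalEquality using (_≡_)

import Algebra.Properties.CommutativeSemigroup as CommSemigroupProperties
open import Data.Bool using (Bool; true; _∧_; T; if_then_else_)
open import Data.Bool.Properties using (T-∧)
open import Data.Empty using (⊥-elim)
open import Data.Fin using (Fin; zero; suc; toℕ; inject₁) renaming (_<_ to _<ᶠ_)
import Data.Fin.Properties as Fin
open import Data.Fin.Permutation.Components using (transpose)
open import Data.List using (List; []; _∷_; _++_; map; concatMap; filter; length; allFin; upTo)
open import Data.List.Properties
  using (map-id; map-cong; map-++; map-∘; map-tabulate; map-applyUpTo; length-map; length-tabulate; length-++;
         ++-identityʳ; ++-assoc; upTo-∷ʳ)
open import Data.List.Membership.Propositional using (_∈_; _∉_)
open import Data.List.Membership.Propositional.Properties using (∈-allFin; ∈-++⁻; ∈-++⁺ˡ; ∈-++⁺ʳ)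
open import Data.List.Relation.Unary.Any using (here; there)
open import Data.List.Relation.Unary.All using (All; []; _∷_; all?)
open import Data.List.Relation.Unary.All.Properties
  using (All¬⇒¬Any; ¬Any⇒All¬)
  renaming (map⁺ to All-map⁺; map⁻ to All-map⁻; tabulate⁺ to All-tabulate⁺; tabulate⁻ to All-tabulate⁻;
            ++⁺ to All-++⁺; ++⁻ to All-++⁻; ++⁻ˡ to All-++⁻ˡ)
open import Data.List.Relation.Unary.Unique.Propositional using (Unique; []; _∷_)
open import Data.List.Relation.Unary.Unique.Propositional.Properties
  using (allFin⁺; Unique[x∷xs]⇒x∉xs) renaming (++⁺ to Unique-++⁺)
open import Data.Nat using (zero; suc; _<_; z≤n; s≤s; NonZero)
open import Data.Nat.Combinatorics.Base using (_P′_)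
open import Data.Nat.Divisibility using (_∣_; divides; _∣?_; ∣-antisym; ∣⇒≤; m%n≡0⇒n∣m; n∣m⇒m%n≡0)
open import Data.Nat.DivMod using (_%_; _/_; m≡m%n+[m/n]*n; m%n<n)
open import Data.Nat.ListAction using (sum)
open import Data.Nat.ListAction.Properties using (sum-++)
open import Data.Nat.Primality using (prime?; euclidsLemma)
import Data.Nat.Properties as ℕ
open import Data.Nat.Properties
  using (+-comm; +-assoc; +-identityʳ; +-suc; +-mono-≤; +-cancelˡ-≡; +-cancelʳ-≡;
         *-comm; *-assoc; *-identityˡ; *-identityʳ; *-zeroʳ; *-distribˡ-+; *-distribʳ-+;
         *-cancelˡ-≡; *-cancelʳ-≡; *-cancelʳ-≤; *-monoʳ-≤; m*n≢0⇒m≢0; _!≢0;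
         +-commutativeSemigroup; *-commutativeSemigroup;
         ≤-refl; ≤-trans; ≤-pred; <⇒≤; <-≤-trans; n≤1+n; m≤n⇒m≤1+n; m<1+n⇒m<n∨m≡n; m≤m+n; m≤n+m; suc-injective;
         n∸n≡0; m+n∸n≡m; m∸n+n≡m; m+[n∸m]≡n; +-∸-assoc; ∸-+-assoc; m+n≤o⇒m≤o∸n)
open import Data.Nat.Tactic.RingSolver using (solve-∀)
open import Data.Product using (Σ; _×_; _,_; proj₁; proj₂)
open import Data.Sum using (_⊎_; inj₁; inj₂; [_,_]′)
open import Data.Vec using (Vec; lookup; toList) renaming ([] to []ᵥ; _∷_ to _∷ᵥ_; tabulate to tabulateᵥ)
open import Data.Vec.Properties using (≡-dec; lookup∘tabulate; tabulate∘lookup; tabulate-cong; length-toList)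
open import Function using (_∘_; const; id)
open import Function.Bundles using (Equivalence)
open import Function.Definitions using (Injective)
open import Relation.Binary.Definitions using (DecidableEquality; tri<; tri≈; tri>)
open import Relation.Binary.PropositionalEquality
  using (_≢_; refl; sym; trans; cong; cong₂; subst; subst₂; setoid; module ≡-Reasoning)
open import Relation.Nullary using (Dec; yes; no; ¬_; does)
open import Relation.Nullary.Decidable using (T?; map′; ¬?; _×-dec_; from-yes)
open import Relation.Unary using (Decidable)

module +-CS = CommSemigroupProperties +-commutativeSemigroup
module *-CS = CommSemigroupProperties *-commutativeSemigroup

variable
  A B : Set
  P Q : Set

-- Sums over lists

-- Defined through `sum ∘ map` so that `desPowSum` (Defs) is literally such a sum.
∑ : List A → (A → ℕ) → ℕ
∑ xs f = sum (map f xs)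

∑-cong : (xs : List A) {f g : A → ℕ} → (∀ x → f x ≡ g x) → ∑ xs f ≡ ∑ xs g
∑-cong xs f≗g = cong sum (map-cong f≗g xs)

∑-zero : (xs : List A) → ∑ xs (const 0) ≡ 0
∑-zero []       = refl
∑-zero (x ∷ xs) = ∑-zero xs

∑-const : (xs : List A) (c : ℕ) → ∑ xs (const c) ≡ length xs * c
∑-const []       c = refl
∑-const (x ∷ xs) c = cong (c +_) (∑-const xs c)

∑-+ : (xs : List A) (f g : A → ℕ) → ∑ xs (λ x → f x + g x) ≡ ∑ xs f + ∑ xs g
∑-+ []       f g = refl
∑-+ (x ∷ xs) f g = trans (cong (f x + g x +_) (∑-+ xs f g)) (+-CS.interchange (f x) (g x) _ _)

∑-*ˡ : (xs : List A) (c : ℕ) (f : A → ℕ) → ∑ xs (λ x → c * f x) ≡ c * ∑ xs f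
∑-*ˡ []       c f = sym (*-zeroʳ c)
∑-*ˡ (x ∷ xs) c f = trans (cong (c * f x +_) (∑-*ˡ xs c f)) (sym (*-distribˡ-+ c (f x) _))

∑-*ʳ : (xs : List A) (c : ℕ) (f : A → ℕ) → ∑ xs (λ x → f x * c) ≡ ∑ xs f * c
∑-*ʳ xs c f = trans (∑-cong xs (λ x → *-comm (f x) c)) (trans (∑-*ˡ xs c f) (*-comm c _))

∑-comm : (xs : List A) (ys : List B) (f : A → B → ℕ) →
  ∑ xs (λ x → ∑ ys (f x)) ≡ ∑ ys (λ y → ∑ xs (λ x → f x y))
∑-comm []       ys f = sym (∑-zero ys)
∑-comm (x ∷ xs) ys f =
  trans (cong (∑ ys (f x) +_) (∑-comm xs ys f)) (sym (∑-+ ys (f x) _))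

∑-++ : (xs ys : List A) (f : A → ℕ) → ∑ (xs ++ ys) f ≡ ∑ xs f + ∑ ys f
∑-++ xs ys f = trans (cong sum (map-++ f xs ys)) (sum-++ (map f xs) _)

∑-map : (g : A → B) (xs : List A) (f : B → ℕ) → ∑ (map g xs) f ≡ ∑ xs (f ∘ g)
∑-map g xs f = cong sum (sym (map-∘ xs))

∑-concatMap : (h : A → List B) (xs : List A) (f : B → ℕ) →
  ∑ (concatMap h xs) f ≡ ∑ xs (λ x → ∑ (h x) f)
∑-concatMap h []       f = refl
∑-concatMap h (x ∷ xs) f =
  trans (∑-++ (h x) (concatMap h xs) f) (cong (∑ (h x) f +_) (∑-concatMap h xs f))

-- Written with `if` so that the summands of `desList` (Defs) are literally indicators.
𝟙 : Dec P → ℕ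
𝟙 d = if does d then 1 else 0

𝟙-yes : (d : Dec P) → P → 𝟙 d ≡ 1
𝟙-yes (yes _) _ = refl
𝟙-yes (no ¬p) p = ⊥-elim (¬p p)

𝟙-no : (d : Dec P) → ¬ P → 𝟙 d ≡ 0
𝟙-no (yes p) ¬p = ⊥-elim (¬p p)
𝟙-no (no _)  _  = refl

𝟙-cong : (d : Dec P) (e : Dec Q) → (P → Q) → (Q → P) → 𝟙 d ≡ 𝟙 e
𝟙-cong (yes p) e to from = sym (𝟙-yes e (to p))
𝟙-cong (no ¬p) e to from = sym (𝟙-no e (¬p ∘ from))

𝟙-× : (d : Dec P) (e : Dec Q) (f : Dec (P × Q)) → 𝟙 f ≡ 𝟙 d * 𝟙 e
𝟙-× (yes p) (yes q) f = 𝟙-yes f (p , q)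
𝟙-× (yes p) (no ¬q) f = 𝟙-no f (¬q ∘ proj₂)
𝟙-× (no ¬p) e       f = 𝟙-no f (¬p ∘ proj₁)

𝟙-¬ : (d : Dec P) (e : Dec (¬ P)) → 𝟙 d + 𝟙 e ≡ 1
𝟙-¬ (yes p) e = cong suc (𝟙-no e (λ ¬p → ¬p p))
𝟙-¬ (no ¬p) e = 𝟙-yes e ¬p

𝟙*-cong : (d : Dec P) {x y : ℕ} → (P → x ≡ y) → 𝟙 d * x ≡ 𝟙 d * y
𝟙*-cong (yes p) x≡y = cong (_+ 0) (x≡y p)
𝟙*-cong (no _)  _   = refl

𝟙-split : {R M : Set} (r : Dec R) (p : Dec M) (q : Dec (¬ M)) (x y : ℕ) →
  (R → M → x ≡ 1) → x ≡ y → 𝟙 r * x ≡ 𝟙 r * 𝟙 p + 𝟙 r * (𝟙 q * y)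
𝟙-split (no _)  _       _ _ _ _   _   = refl
𝟙-split (yes r) (yes m) q x y x≡1 _   rewrite x≡1 r m | 𝟙-no q (λ ¬m → ¬m m) = refl
𝟙-split (yes r) (no ¬m) q x y _   x≡y rewrite 𝟙-yes q ¬m | x≡y =
  trans (*-identityˡ y) (sym (trans (*-identityˡ (1 * y)) (*-identityˡ y)))

∑-filter : {R : A → Set} (R? : Decidable R) (xs : List A) (f : A → ℕ) →
  ∑ (filter R? xs) f ≡ ∑ xs (λ x → 𝟙 (R? x) * f x)
∑-filter R? []       f = refl
∑-filter R? (x ∷ xs) f with R? x
... | yes _ = cong₂ _+_ (sym (+-identityʳ (f x))) (∑-filter R? xs f)
... | no  _ = ∑-filter R? xs f

∑-upTo-suc : (N : ℕ) (f : ℕ → ℕ) → ∑ (upTo (suc N)) f ≡ f 0 + ∑ (upTo N) (f ∘ suc)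
∑-upTo-suc N f = cong (f 0 +_) (cong sum (trans (map-applyUpTo suc f N) (sym (map-applyUpTo id (f ∘ suc) N))))

∑-upTo-δ : ∀ {N m₀} → m₀ < N → ∑ (upTo N) (λ m → 𝟙 (m ℕ.≟ m₀)) ≡ 1
∑-upTo-δ {suc N} {zero}   _         = trans (∑-upTo-suc N (λ m → 𝟙 (m ℕ.≟ 0))) (cong suc (∑-zero (upTo N)))
∑-upTo-δ {suc N} {suc m₀} (s≤s m₀<N) = trans (∑-upTo-suc N (λ m → 𝟙 (m ℕ.≟ suc m₀))) (∑-upTo-δ m₀<N)

module _ {R : ℕ → Set} (R? : Decidable R) (N : ℕ) where

  ∑-upTo-unique : ∀ {m₀} → m₀ < N → R m₀ → (∀ {m} → R m → m ≡ m₀) → ∑ (upTo N) (λ m → 𝟙 (R? m)) ≡ 1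
  ∑-upTo-unique {m₀} m₀<N Rm₀ unique =
    trans (∑-cong (upTo N) (λ m → 𝟙-cong (R? m) (m ℕ.≟ m₀) unique (λ { refl → Rm₀ }))) (∑-upTo-δ m₀<N)

  ∑-upTo-none : (∀ m → ¬ R m) → ∑ (upTo N) (λ m → 𝟙 (R? m)) ≡ 0
  ∑-upTo-none none = trans (∑-cong (upTo N) (λ m → 𝟙-no (R? m) (none m))) (∑-zero (upTo N))

∑-upTo-∷ʳ : (N : ℕ) (f : ℕ → ℕ) → ∑ (upTo (suc N)) f ≡ ∑ (upTo N) f + f N
∑-upTo-∷ʳ N f = trans (cong (λ xs → ∑ xs f) (sym (upTo-∷ʳ N))) (trans (∑-++ (upTo N) (N ∷ []) f) (cong (∑ (upTo N) f +_) (+-identityʳ (f N))))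

τ≡∑ : ∀ k → τ k ≡ ∑ (upTo k) (λ m → 𝟙 (suc m ∣? k))
τ≡∑ k = begin
  length (divisors k)                                 ≡⟨ sym (*-identityʳ _) ⟩
  length (divisors k) * 1                             ≡⟨ sym (∑-const (divisors k) 1) ⟩
  ∑ (divisors k) (const 1)                            ≡⟨ ∑-filter (_∣? k) (map suc (upTo k)) (const 1) ⟩
  ∑ (map suc (upTo k)) (λ d → 𝟙 (d ∣? k) * 1)         ≡⟨ ∑-map suc (upTo k) _ ⟩
  ∑ (upTo k) (λ m → 𝟙 (suc m ∣? k) * 1)               ≡⟨ ∑-cong (upTo k) (λ m → *-identityʳ _) ⟩
  ∑ (upTo k) (λ m → 𝟙 (suc m ∣? k))                   ∎
  where open ≡-Reasoning

σ≡∑ : ∀ k → σ k ≡ ∑ (upTo k) (λ m → 𝟙 (suc m ∣? k) * suc m)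
σ≡∑ k = begin
  sum (divisors k)                           ≡⟨ cong sum (sym (map-id (divisors k))) ⟩
  ∑ (divisors k) id                          ≡⟨ ∑-filter (_∣? k) (map suc (upTo k)) id ⟩
  ∑ (map suc (upTo k)) (λ d → 𝟙 (d ∣? k) * d) ≡⟨ ∑-map suc (upTo k) _ ⟩
  ∑ (upTo k) (λ m → 𝟙 (suc m ∣? k) * suc m)  ∎
  where open ≡-Reasoning

∑-divisors-const : ∀ K (g : ℕ → ℕ) {c} → (∀ m → suc m ∣ K → g m ≡ c) → ∑ (upTo K) (λ m → 𝟙 (suc m ∣? K) * g m) ≡ τ K * c
∑-divisors-const K g {c} g≡c = begin
  ∑ (upTo K) (λ m → 𝟙 (suc m ∣? K) * g m) ≡⟨ ∑-cong (upTo K) (λ m → 𝟙*-cong (suc m ∣? K) (g≡c m)) ⟩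
  ∑ (upTo K) (λ m → 𝟙 (suc m ∣? K) * c)   ≡⟨ ∑-*ʳ (upTo K) c _ ⟩
  ∑ (upTo K) (λ m → 𝟙 (suc m ∣? K)) * c   ≡⟨ cong (_* c) (sym (τ≡∑ K)) ⟩
  τ K * c                                 ∎
  where open ≡-Reasoning

τ≡∑-beyond : ∀ k d → τ (suc k) ≡ ∑ (upTo (suc k + d)) (λ m → 𝟙 (suc m ∣? suc k))
τ≡∑-beyond k zero    = trans (τ≡∑ (suc k)) (cong (λ N → ∑ (upTo N) (λ m → 𝟙 (suc m ∣? suc k))) (sym (+-identityʳ (suc k))))
τ≡∑-beyond k (suc d) = begin
  τ (suc k)                                                                        ≡⟨ τ≡∑-beyond k d ⟩
  ∑ (upTo (suc k + d)) D                                                           ≡⟨ sym (+-identityʳ _) ⟩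
  ∑ (upTo (suc k + d)) D + 0                                                       ≡⟨ cong (∑ (upTo (suc k + d)) D +_) (sym too-large) ⟩
  ∑ (upTo (suc k + d)) D + D (suc k + d)                                           ≡⟨ sym (∑-upTo-∷ʳ (suc k + d) D) ⟩
  ∑ (upTo (suc (suc k + d))) D                                                     ≡⟨ cong (λ N → ∑ (upTo N) D) (sym (+-suc (suc k) d)) ⟩
  ∑ (upTo (suc k + suc d)) D                                                       ∎
  where
  open ≡-Reasoning
  D : ℕ → ℕ
  D m = 𝟙 (suc m ∣? suc k)
  too-large : D (suc k + d) ≡ 0
  too-large = 𝟙-no (suc (suc k + d) ∣? suc k) (λ ∣K → ℕ.<-irrefl refl (≤-trans (s≤s (m≤m+n (suc k) d)) (∣⇒≤ ∣K)))

Enumerates : DecidableEquality A → List A → Set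
Enumerates _≟_ xs = ∀ u → ∑ xs (λ x → 𝟙 (x ≟ u)) ≡ 1

module Enumeration {A : Set} (_≟_ : DecidableEquality A) (xs : List A) (enum : Enumerates _≟_ xs) where

  open import Data.List.Membership.DecPropositional _≟_ using (_∈?_; _∉?_)

  ∑-δ : (u : A) (f : A → ℕ) → ∑ xs (λ x → 𝟙 (x ≟ u) * f x) ≡ f u
  ∑-δ u f = begin
    ∑ xs (λ x → 𝟙 (x ≟ u) * f x)   ≡⟨ ∑-cong xs (λ x → 𝟙*-cong (x ≟ u) (cong f)) ⟩
    ∑ xs (λ x → 𝟙 (x ≟ u) * f u)   ≡⟨ ∑-*ʳ xs (f u) _ ⟩
    ∑ xs (λ x → 𝟙 (x ≟ u)) * f u   ≡⟨ cong (_* f u) (enum u) ⟩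
    f u + 0                        ≡⟨ +-identityʳ (f u) ⟩
    f u                            ∎
    where open ≡-Reasoning

  ∑-involution : (g : A → A) → (∀ x → g (g x) ≡ x) → (f : A → ℕ) → ∑ xs (f ∘ g) ≡ ∑ xs f
  ∑-involution g gg f = begin
    ∑ xs (f ∘ g)                                       ≡⟨ ∑-cong xs (λ x → sym (∑-δ (g x) f)) ⟩
    ∑ xs (λ x → ∑ xs (λ y → 𝟙 (y ≟ g x) * f y))       ≡⟨ ∑-comm xs xs _ ⟩
    ∑ xs (λ y → ∑ xs (λ x → 𝟙 (y ≟ g x) * f y))       ≡⟨ ∑-cong xs (λ y → ∑-cong xs (λ x →
                                                            cong (_* f y) (𝟙-cong (y ≟ g x) (x ≟ g y) flip flip))) ⟩
    ∑ xs (λ y → ∑ xs (λ x → 𝟙 (x ≟ g y) * f y))       ≡⟨ ∑-cong xs (λ y → ∑-δ (g y) (const (f y))) ⟩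
    ∑ xs f                                             ∎
    where
    open ≡-Reasoning
    flip : ∀ {x y} → y ≡ g x → x ≡ g y
    flip {x} refl = sym (gg x)

  ∑-δ′ : (u : A) (f : A → ℕ) → ∑ xs (λ x → 𝟙 (u ≟ x) * f x) ≡ f u
  ∑-δ′ u f = trans (∑-cong xs (λ x → cong (_* f x) (𝟙-cong (u ≟ x) (x ≟ u) sym sym))) (∑-δ u f)

  ∑-∈ : (L : List A) → Unique L → ∑ xs (λ x → 𝟙 (x ∈? L)) ≡ length L
  ∑-∈ []      _           = ∑-zero xs
  ∑-∈ (y ∷ L) uniq@(_ ∷ uniqL) = begin
    ∑ xs (λ x → 𝟙 (x ∈? y ∷ L))                     ≡⟨ ∑-cong xs (λ x → 𝟙-∈-∷ x (x ≟ y) (x ∈? L)) ⟩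
    ∑ xs (λ x → 𝟙 (x ≟ y) * 1 + 𝟙 (x ∈? L))         ≡⟨ ∑-+ xs _ _ ⟩
    ∑ xs (λ x → 𝟙 (x ≟ y) * 1) + ∑ xs (λ x → 𝟙 (x ∈? L))
                                                     ≡⟨ cong₂ _+_ (∑-δ y (const 1)) (∑-∈ L uniqL) ⟩
    suc (length L)                                   ∎
    where
    open ≡-Reasoning
    y∉L : y ∉ L
    y∉L = Unique[x∷xs]⇒x∉xs uniq
    𝟙-∈-∷ : ∀ x (x≟y : Dec (x ≡ y)) (x∈?L : Dec (x ∈ L)) → 𝟙 (x ∈? y ∷ L) ≡ 𝟙 x≟y * 1 + 𝟙 x∈?L
    𝟙-∈-∷ x (yes refl) x∈?L     = trans (𝟙-yes (x ∈? x ∷ L) (here refl)) (cong suc (sym (𝟙-no x∈?L y∉L)))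
    𝟙-∈-∷ x (no x≢y)   (yes x∈L) = 𝟙-yes (x ∈? y ∷ L) (there x∈L)
    𝟙-∈-∷ x (no x≢y)   (no x∉L)  = 𝟙-no (x ∈? y ∷ L) (λ { (here x≡y) → x≢y x≡y ; (there x∈L) → x∉L x∈L })

  ∑-∉ : (L : List A) → Unique L → ∑ xs (λ x → 𝟙 (x ∉? L)) + length L ≡ length xs
  ∑-∉ L uniq = begin
    ∑ xs (λ x → 𝟙 (x ∉? L)) + length L                       ≡⟨ cong (∑ xs (λ x → 𝟙 (x ∉? L)) +_) (sym (∑-∈ L uniq)) ⟩
    ∑ xs (λ x → 𝟙 (x ∉? L)) + ∑ xs (λ x → 𝟙 (x ∈? L))       ≡⟨ sym (∑-+ xs _ _) ⟩
    ∑ xs (λ x → 𝟙 (x ∉? L) + 𝟙 (x ∈? L))                     ≡⟨ ∑-cong xs (λ x → trans (+-comm (𝟙 (x ∉? L)) _) (𝟙-¬ (x ∈? L) (x ∉? L))) ⟩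
    ∑ xs (const 1)                                            ≡⟨ ∑-const xs 1 ⟩
    length xs * 1                                             ≡⟨ *-identityʳ _ ⟩
    length xs                                                 ∎
    where open ≡-Reasoning

∑-allFin-suc : (n : ℕ) (f : Fin (suc n) → ℕ) → ∑ (allFin (suc n)) f ≡ f zero + ∑ (allFin n) (f ∘ suc)
∑-allFin-suc n f = cong (f zero +_) (cong sum (trans (map-tabulate suc f) (sym (map-tabulate id (f ∘ suc)))))

allFin-enumerates : (n : ℕ) → Enumerates Fin._≟_ (allFin n)
allFin-enumerates (suc n) zero    = trans (∑-allFin-suc n (λ x → 𝟙 (x Fin.≟ zero))) (cong suc (∑-zero (allFin n)))
allFin-enumerates (suc n) (suc u) = trans (∑-allFin-suc n (λ x → 𝟙 (x Fin.≟ suc u))) (allFin-enumerates n u)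

module OverFin {n : ℕ} = Enumeration (Fin._≟_ {n}) (allFin n) (allFin-enumerates n)

∑-allVecs-suc : (n m : ℕ) (f : Vec (Fin n) (suc m) → ℕ) →
  ∑ (allVecs n (suc m)) f ≡ ∑ (allVecs n m) (λ v → ∑ (allFin n) (λ z → f (z ∷ᵥ v)))
∑-allVecs-suc n m f =
  trans (∑-concatMap _ (allVecs n m) f) (∑-cong (allVecs n m) (λ v → ∑-map (_∷ᵥ v) (allFin n) f))

allVecs-enumerates : (n m : ℕ) → Enumerates (≡-dec Fin._≟_) (allVecs n m)
allVecs-enumerates n zero    []ᵥ        = refl
allVecs-enumerates n (suc m) (u ∷ᵥ us) = begin
  ∑ (allVecs n (suc m)) (λ v → 𝟙 (v ≟ᵥ (u ∷ᵥ us)))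
    ≡⟨ ∑-allVecs-suc n m _ ⟩
  ∑ (allVecs n m) (λ v → ∑ (allFin n) (λ z → 𝟙 ((z Fin.≟ u) ×-dec (v ≟ᵥ us))))
    ≡⟨ ∑-cong (allVecs n m) (λ v → ∑-cong (allFin n) (λ z → 𝟙-× (z Fin.≟ u) (v ≟ᵥ us) ((z Fin.≟ u) ×-dec (v ≟ᵥ us)))) ⟩
  ∑ (allVecs n m) (λ v → ∑ (allFin n) (λ z → 𝟙 (z Fin.≟ u) * 𝟙 (v ≟ᵥ us)))
    ≡⟨ ∑-cong (allVecs n m) (λ v → OverFin.∑-δ u (const (𝟙 (v ≟ᵥ us)))) ⟩
  ∑ (allVecs n m) (λ v → 𝟙 (v ≟ᵥ us))
    ≡⟨ allVecs-enumerates n m us ⟩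
  1 ∎
  where
  open ≡-Reasoning
  _≟ᵥ_ : ∀ {k} → DecidableEquality (Vec (Fin n) k)
  _≟ᵥ_ = ≡-dec Fin._≟_

module OverVec {n m : ℕ} = Enumeration (≡-dec {n = m} (Fin._≟_ {n})) (allVecs n m) (allVecs-enumerates n m)

module _ (B : List A → Bool) (q : A → Bool)
         (B-[] : B [] ≡ true) (B-∷ : ∀ x xs → B (x ∷ xs) ≡ (q x ∧ B xs)) where

  fold-sound : ∀ xs → T (B xs) → ∀ {x} → x ∈ xs → T (q x)
  fold-sound (y ∷ xs) t (here refl) = proj₁ (Equivalence.to T-∧ (subst T (B-∷ y xs) t))
  fold-sound (y ∷ xs) t (there x∈xs) = fold-sound xs (proj₂ (Equivalence.to T-∧ (subst T (B-∷ y xs) t))) x∈xs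

  fold-complete : ∀ xs → (∀ {x} → x ∈ xs → T (q x)) → T (B xs)
  fold-complete []       _  = subst T (sym B-[]) _
  fold-complete (y ∷ xs) qs = subst T (sym (B-∷ y xs))
    (Equivalence.from T-∧ (qs (here refl) , fold-complete xs (qs ∘ there)))

module _ {A : Set} where

  open import Data.List.Relation.Binary.Permutation.Setoid (setoid A) using (↭-sym)
  open import Data.List.Relation.Binary.Permutation.Setoid.Properties (setoid A)
    using (Unique-resp-↭; ↭-shift; ++-comm; ∷↭∷ʳ) renaming (++⁺ to ↭-++⁺)

  Unique-shift : ∀ xs {v : A} ys → Unique (xs ++ v ∷ ys) → Unique (v ∷ xs ++ ys)
  Unique-shift xs ys = Unique-resp-↭ (↭-shift xs ys)

  Unique-unshift : ∀ xs {v : A} ys → Unique (v ∷ xs ++ ys) → Unique (xs ++ v ∷ ys)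
  Unique-unshift xs ys = Unique-resp-↭ (↭-sym (↭-shift xs ys))

  Unique-rotate : ∀ xs {v : A} → Unique (xs ++ v ∷ []) → Unique (v ∷ xs)
  Unique-rotate xs {v} u = subst (Unique ∘ (v ∷_)) (++-identityʳ xs) (Unique-shift xs [] u)

  Unique[xs∷ʳx]⇒x∉xs : ∀ xs {v : A} → Unique (xs ++ v ∷ []) → v ∉ xs
  Unique[xs∷ʳx]⇒x∉xs xs u = Unique[x∷xs]⇒x∉xs (Unique-rotate xs u)

  Unique-++-comm : ∀ xs ys → Unique (xs ++ ys) → Unique (ys ++ xs)
  Unique-++-comm xs ys = Unique-resp-↭ (++-comm xs ys)

  Unique-rotate-++ : ∀ xs ys {u v : A} → Unique ((xs ++ u ∷ []) ++ (ys ++ v ∷ [])) → Unique ((u ∷ xs) ++ (v ∷ ys))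
  Unique-rotate-++ xs ys {u} {v} = Unique-resp-↭ (↭-sym (↭-++⁺ (∷↭∷ʳ u xs) (∷↭∷ʳ v ys)))

  Unique-++⁻ : ∀ xs {ys : List A} → Unique (xs ++ ys) → Unique xs × Unique ys
  Unique-++⁻ []       u          = [] , u
  Unique-++⁻ (x ∷ xs) (x∉ ∷ u) = (All-++⁻ˡ xs x∉ ∷ proj₁ (Unique-++⁻ xs u)) , proj₂ (Unique-++⁻ xs u)

  Unique-split : ∀ xs {v : A} ys → Unique (xs ++ v ∷ ys) → Unique (xs ++ v ∷ []) × v ∉ ys × Unique ys
  Unique-split xs {v} ys u with Unique-++⁻ xs u
  ... | _ , v∉ys ∷ suffix =
    proj₁ (Unique-++⁻ (xs ++ v ∷ []) (subst Unique (sym (++-assoc xs (v ∷ []) ys)) u)) , All¬⇒¬Any v∉ys , suffix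

least : {R : ℕ → Set} → Decidable R → (k : ℕ) →
  (Σ ℕ λ d → d < k × R d × (∀ i → i < d → ¬ R i)) ⊎ (∀ i → i < k → ¬ R i)
least R? zero = inj₂ (λ _ ())
least R? (suc k) with least R? k
... | inj₁ (d , d<k , Rd , below) = inj₁ (d , m≤n⇒m≤1+n d<k , Rd , below)
... | inj₂ none with R? k
...   | yes Rk = inj₁ (k , ≤-refl , Rk , none)
...   | no ¬Rk = inj₂ (λ i i<1+k → [ none i , (λ { refl → ¬Rk }) ]′ (m<1+n⇒m<n∨m≡n i<1+k))

-- Permutations in one-line notation

IsPermutation : {n : ℕ} → Vec (Fin n) n → Set
IsPermutation v = Injective _≡_ _≡_ (lookup v)

-- `injective? v` is a fold over `allFin n` of a fold over `allFin n`, built from helpers local to Defs.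
-- Each `mutual` block names one of them: the hole is solved by unification with the `refl` proof of the
-- equation next to it, once `allFin n` has been abstracted (by rewriting) so that the equation is a pattern.
module InjectiveCheck {n : ℕ} (v : Vec (Fin n) n) where

  mutual
    check : List (Fin n) → Bool
    check = _

    check-allFin : ∀ L → allFin n ≡ L → check L ≡ injective? v
    check-allFin L eq rewrite eq = refl

  mutual
    diagonal : Fin n → Bool
    diagonal = _

    check-[-] : ∀ x → check (x ∷ []) ≡ ((diagonal x ∧ true) ∧ true)
    check-[-] x = refl

  mutual
    row : Fin n → List (Fin n) → Bool
    row = _

    rest : Fin n → List (Fin n) → Bool
    rest = _

    check-∷ : ∀ x L → check (x ∷ L) ≡ ((diagonal x ∧ row x L) ∧ rest x L)
    check-∷ x L = refl

  mutual
    entry : Fin n → Fin n → Bool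
    entry = _

    row-∷ : ∀ x y L → row x (y ∷ L) ≡ (entry x y ∧ row x L)
    row-∷ x y L = refl

  mutual
    all : (Fin n → Bool) → List (Fin n) → Bool
    all = _

    all-rows : ∀ p L → p ≡ (λ i → row i L) → all p L ≡ check L
    all-rows p L eq rewrite sym eq = refl

  all-∷ : ∀ p x L → all p (x ∷ L) ≡ (p x ∧ all p L)
  all-∷ p x L = refl

  full-row : Fin n → Bool
  full-row i = row i (allFin n)

  injective?≡all : injective? v ≡ all full-row (allFin n)
  injective?≡all = sym (trans (all-rows _ (allFin n) refl) (check-allFin (allFin n) refl))

  entry-sound : ∀ x y → T (entry x y) → lookup v x ≡ lookup v y → x ≡ y
  entry-sound x y t eq with x Fin.≟ y
  ... | yes x≡y = x≡y
  ... | no  _   with lookup v x Fin.≟ lookup v y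
  ...   | yes _  = ⊥-elim t
  ...   | no neq = ⊥-elim (neq eq)

  entry-complete : ∀ x y → (lookup v x ≡ lookup v y → x ≡ y) → T (entry x y)
  entry-complete x y inj with x Fin.≟ y
  ... | yes _   = _
  ... | no  x≢y with lookup v x Fin.≟ lookup v y
  ...   | yes eq = x≢y (inj eq)
  ...   | no  _  = _

  sound : T (injective? v) → IsPermutation v
  sound t {i} {j} = entry-sound i j
    (fold-sound (row i) (entry i) refl (row-∷ i) (allFin n)
      (fold-sound (all full-row) full-row refl (all-∷ full-row) (allFin n) (subst T injective?≡all t) (∈-allFin i))
      (∈-allFin j))

  complete : IsPermutation v → T (injective? v)
  complete inj = subst T (sym injective?≡all) (fold-complete (all full-row) full-row refl (all-∷ full-row) (allFin n)
    (λ {i} _ → fold-complete (row i) (entry i) refl (row-∷ i) (allFin n) (λ {j} _ → entry-complete i j inj)))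

isPermutation? : {n : ℕ} (v : Vec (Fin n) n) → Dec (IsPermutation v)
isPermutation? v = map′ (InjectiveCheck.sound v) (InjectiveCheck.complete v) (T? (injective? v))

∑Perm : (n : ℕ) → (Vec (Fin n) n → ℕ) → ℕ
∑Perm n f = ∑ (allVecs n n) (λ v → 𝟙 (isPermutation? v) * f v)

∑-Sym : (n : ℕ) (f : Vec (Fin n) n → ℕ) → ∑ (Sym n) f ≡ ∑Perm n f
∑-Sym n = ∑-filter (T? ∘ injective?) (allVecs n n)

module _ (n : ℕ) where

  ∑Perm-cong : {f g : Vec (Fin n) n → ℕ} → (∀ v → IsPermutation v → f v ≡ g v) → ∑Perm n f ≡ ∑Perm n g
  ∑Perm-cong f≗g = ∑-cong (allVecs n n) (λ v → 𝟙*-cong (isPermutation? v) (f≗g v))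

  ∑Perm-+ : (f g : Vec (Fin n) n → ℕ) → ∑Perm n (λ v → f v + g v) ≡ ∑Perm n f + ∑Perm n g
  ∑Perm-+ f g = trans (∑-cong (allVecs n n) (λ v → *-distribˡ-+ (𝟙 (isPermutation? v)) (f v) (g v)))
                      (∑-+ (allVecs n n) _ _)

  ∑Perm-*ˡ : (c : ℕ) (f : Vec (Fin n) n → ℕ) → ∑Perm n (λ v → c * f v) ≡ c * ∑Perm n f
  ∑Perm-*ˡ c f = trans (∑-cong (allVecs n n) (λ v → *-CS.x∙yz≈y∙xz (𝟙 (isPermutation? v)) c (f v)))
                       (∑-*ˡ (allVecs n n) c _)

  ∑Perm-comm : (xs : List A) (f : Vec (Fin n) n → A → ℕ) →
    ∑Perm n (λ v → ∑ xs (f v)) ≡ ∑ xs (λ x → ∑Perm n (λ v → f v x))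
  ∑Perm-comm xs f = trans (∑-cong (allVecs n n) (λ v → sym (∑-*ˡ xs (𝟙 (isPermutation? v)) (f v))))
                          (∑-comm (allVecs n n) xs _)

module _ {n : ℕ} where

  compose : (Fin n → Fin n) → Vec (Fin n) n → (Fin n → Fin n) → Vec (Fin n) n
  compose s v r = tabulateᵥ (s ∘ lookup v ∘ r)

  module _ (s r : Fin n → Fin n) (s-inv : ∀ x → s (s x) ≡ x) (r-inv : ∀ x → r (r x) ≡ x) where

    compose-involutive : ∀ v → compose s (compose s v r) r ≡ v
    compose-involutive v = trans (tabulate-cong (λ i → trans (cong s (lookup∘tabulate _ (r i)))
                                   (trans (s-inv _) (cong (lookup v) (r-inv i)))))
                                 (tabulate∘lookup v)

    compose-isPermutation : ∀ v → IsPermutation v → IsPermutation (compose s v r)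
    compose-isPermutation v inj {i} {j} eq = begin
      i           ≡⟨ sym (r-inv i) ⟩
      r (r i)     ≡⟨ cong r (inj (begin
                       lookup v (r i)          ≡⟨ sym (s-inv _) ⟩
                       s (s (lookup v (r i)))  ≡⟨ cong s (trans (sym (lookup∘tabulate _ i)) (trans eq (lookup∘tabulate _ j))) ⟩
                       s (s (lookup v (r j)))  ≡⟨ s-inv _ ⟩
                       lookup v (r j)          ∎)) ⟩
      r (r j)     ≡⟨ r-inv j ⟩
      j           ∎
      where open ≡-Reasoning

    ∑Perm-compose : (f : Vec (Fin n) n → ℕ) → ∑Perm n (λ v → f (compose s v r)) ≡ ∑Perm n f
    ∑Perm-compose f = begin
      ∑Perm n (λ v → f (compose s v r))
        ≡⟨ ∑-cong (allVecs n n) (λ v → cong (_* f (compose s v r)) (𝟙-cong (isPermutation? v) (isPermutation? (compose s v r))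
             (compose-isPermutation v) (subst IsPermutation (compose-involutive v) ∘ compose-isPermutation (compose s v r)))) ⟩
      ∑ (allVecs n n) ((λ v → 𝟙 (isPermutation? v) * f v) ∘ (λ v → compose s v r))
        ≡⟨ OverVec.∑-involution (λ v → compose s v r) compose-involutive _ ⟩
      ∑Perm n f ∎
      where open ≡-Reasoning

iter-+ : (f : A → A) (i j : ℕ) (x : A) → iter f (i + j) x ≡ iter f i (iter f j x)
iter-+ f zero    j x = refl
iter-+ f (suc i) j x = cong f (iter-+ f i j x)

iter-sucʳ : (f : A → A) (k : ℕ) (x : A) → iter f (suc k) x ≡ iter f k (f x)
iter-sucʳ f zero    x = refl
iter-sucʳ f (suc k) x = cong f (iter-sucʳ f k x)

iter-comm : (f : A → A) (i j : ℕ) (x : A) → iter f i (iter f j x) ≡ iter f j (iter f i x)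
iter-comm f i j x = trans (sym (iter-+ f i j x)) (trans (cong (λ t → iter f t x) (+-comm i j)) (iter-+ f j i x))

iter-injective : {f : A → A} → Injective _≡_ _≡_ f → (k : ℕ) → Injective _≡_ _≡_ (iter f k)
iter-injective f-inj zero    eq = eq
iter-injective f-inj (suc k) eq = iter-injective f-inj k (f-inj eq)

iter-periodic : (f : A → A) (d q : ℕ) {x : A} → iter f d x ≡ x → iter f (q * d) x ≡ x
iter-periodic f d zero    _   = refl
iter-periodic f d (suc q) {x} fix = begin
  iter f (d + q * d) x             ≡⟨ cong (λ t → iter f t x) (+-comm d (q * d)) ⟩
  iter f (q * d + d) x             ≡⟨ iter-+ f (q * d) d x ⟩
  iter f (q * d) (iter f d x)      ≡⟨ cong (iter f (q * d)) fix ⟩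
  iter f (q * d) x                 ≡⟨ iter-periodic f d q fix ⟩
  x                                ∎
  where open ≡-Reasoning

iter-conjugate : {n : ℕ} (s : Fin n → Fin n) (s-inv : ∀ x → s (s x) ≡ x) (v : Vec (Fin n) n) (k : ℕ) (x : Fin n) →
  iter (lookup (compose s v s)) k x ≡ s (iter (lookup v) k (s x))
iter-conjugate s s-inv v zero    x = sym (s-inv x)
iter-conjugate s s-inv v (suc k) x = begin
  lookup (compose s v s) (iter (lookup (compose s v s)) k x)  ≡⟨ cong (lookup (compose s v s)) (iter-conjugate s s-inv v k x) ⟩
  lookup (compose s v s) (s y)                                ≡⟨ lookup∘tabulate _ (s y) ⟩
  s (lookup v (s (s y)))                                      ≡⟨ cong (s ∘ lookup v) (s-inv y) ⟩
  s (lookup v y)                                              ∎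
  where
  open ≡-Reasoning
  y = iter (lookup v) k (s x)

module _ {n : ℕ} (i j : Fin n) where

  transpose-matchˡ : transpose i j i ≡ j
  transpose-matchˡ with i Fin.≟ i
  ... | yes _   = refl
  ... | no  i≢i = ⊥-elim (i≢i refl)

  transpose-matchʳ : transpose i j j ≡ i
  transpose-matchʳ with j Fin.≟ i
  ... | yes j≡i = j≡i
  ... | no  _   with j Fin.≟ j
  ...   | yes _   = refl
  ...   | no  j≢j = ⊥-elim (j≢j refl)

  transpose-other : ∀ {k} → k ≢ i → k ≢ j → transpose i j k ≡ k
  transpose-other {k} k≢i k≢j with k Fin.≟ i
  ... | yes k≡i = ⊥-elim (k≢i k≡i)
  ... | no  _   with k Fin.≟ j
  ...   | yes k≡j = ⊥-elim (k≢j k≡j)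
  ...   | no  _   = refl

  transpose-involutive : ∀ k → transpose i j (transpose i j k) ≡ k
  transpose-involutive k with k Fin.≟ i
  ... | yes refl = transpose-matchʳ
  ... | no  k≢i  with k Fin.≟ j
  ...   | yes refl = transpose-matchˡ
  ...   | no  k≢j  = transpose-other k≢i k≢j

nP′k*[n∸k]!≡n! : (n k : ℕ) → k ≤ n → (n P′ k) * (n ∸ k) ! ≡ n !
nP′k*[n∸k]!≡n! n zero    _   = +-identityʳ (n !)
nP′k*[n∸k]!≡n! n (suc k) k<n = begin
  (n ∸ k) * (n P′ k) * (n ∸ suc k) !   ≡⟨ cong (_* (n ∸ suc k) !) (*-comm (n ∸ k) _) ⟩
  (n P′ k) * (n ∸ k) * (n ∸ suc k) !   ≡⟨ *-assoc (n P′ k) _ _ ⟩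
  (n P′ k) * ((n ∸ k) * (n ∸ suc k) !) ≡⟨ cong ((n P′ k) *_) (unfold-! n k k<n) ⟩
  (n P′ k) * (n ∸ k) !                 ≡⟨ nP′k*[n∸k]!≡n! n k (≤-trans (n≤1+n k) k<n) ⟩
  n !                                ∎
  where
  open ≡-Reasoning
  unfold-! : ∀ n k → suc k ≤ n → (n ∸ k) * (n ∸ suc k) ! ≡ (n ∸ k) !
  unfold-! (suc n) zero    _         = refl
  unfold-! (suc n) (suc k) (s≤s k<n) = unfold-! n k k<n

nP′k≢0 : (n k : ℕ) → k ≤ n → NonZero (n P′ k)
nP′k≢0 n k k≤n = m*n≢0⇒m≢0 (n P′ k) {{subst NonZero (sym (nP′k*[n∸k]!≡n! n k k≤n)) (n !≢0)}}

module _ {n : ℕ} where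

  open import Data.List.Membership.DecPropositional (Fin._≟_ {n}) public using (_∈?_; _∉?_)
  open import Data.List.Relation.Unary.Unique.DecPropositional (Fin._≟_ {n}) public using (unique?)

-- Permutations with prescribed values

Constraints : ℕ → Set
Constraints n = List (Fin n × Fin n)

module _ {n : ℕ} where

  dom cod : Constraints n → List (Fin n)
  dom = map proj₁
  cod = map proj₂

  Satisfies : Vec (Fin n) n → Constraints n → Set
  Satisfies v = All (λ c → lookup v (proj₁ c) ≡ proj₂ c)

  satisfies? : (v : Vec (Fin n) n) (cs : Constraints n) → Dec (Satisfies v cs)
  satisfies? v = all? (λ c → lookup v (proj₁ c) Fin.≟ proj₂ c)

  Valid : Constraints n → Set
  Valid cs = Unique (dom cs) × Unique (cod cs)

  #Sat : Constraints n → ℕ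
  #Sat cs = ∑Perm n (λ v → 𝟙 (satisfies? v cs))

  𝟙-satisfies-∷ : ∀ v y z cs → 𝟙 (satisfies? v ((y , z) ∷ cs)) ≡ 𝟙 (lookup v y Fin.≟ z) * 𝟙 (satisfies? v cs)
  𝟙-satisfies-∷ v y z cs = 𝟙-× (lookup v y Fin.≟ z) (satisfies? v cs) ((lookup v y Fin.≟ z) ×-dec satisfies? v cs)

  𝟙-satisfies-++ : ∀ v cs ds → 𝟙 (satisfies? v (cs ++ ds)) ≡ 𝟙 (satisfies? v cs) * 𝟙 (satisfies? v ds)
  𝟙-satisfies-++ v cs ds = trans (𝟙-cong (satisfies? v (cs ++ ds)) (satisfies? v cs ×-dec satisfies? v ds)
                                         (All-++⁻ cs) (λ (sat₁ , sat₂) → All-++⁺ sat₁ sat₂))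
                                 (𝟙-× (satisfies? v cs) (satisfies? v ds) (satisfies? v cs ×-dec satisfies? v ds))

  cod-avoids : ∀ v → IsPermutation v → ∀ cs → Satisfies v cs → ∀ {y} → y ∉ dom cs → lookup v y ∉ cod cs
  cod-avoids v inj (_ ∷ cs) (vy′≡z′ ∷ _)   y∉ (here vy≡z′) = y∉ (here (inj (trans vy≡z′ (sym vy′≡z′))))
  cod-avoids v inj (_ ∷ cs) (_      ∷ sat) y∉ (there p)    = cod-avoids v inj cs sat (y∉ ∘ there) p

  module _ (t : Fin n → Fin n) where

    satisfies-postcompose : ∀ v cs → (∀ {w} → w ∈ cod cs → t w ≡ w) → Satisfies v cs → Satisfies (compose t v id) cs
    satisfies-postcompose v []       fix []         = []
    satisfies-postcompose v (c ∷ cs) fix (eq ∷ sat) =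
      trans (lookup∘tabulate _ (proj₁ c)) (trans (cong t eq) (fix (here refl))) ∷ satisfies-postcompose v cs (fix ∘ there) sat

    satisfies-postcompose-∷ : ∀ v y w cs → (∀ {u} → u ∈ cod cs → t u ≡ u) →
      Satisfies v ((y , w) ∷ cs) → Satisfies (compose t v id) ((y , t w) ∷ cs)
    satisfies-postcompose-∷ v y w cs fix (eq ∷ sat) = trans (lookup∘tabulate _ y) (cong t eq) ∷ satisfies-postcompose v cs fix sat

  #Sat-retarget : ∀ y {z z′} cs → z ∉ cod cs → z′ ∉ cod cs → #Sat ((y , z) ∷ cs) ≡ #Sat ((y , z′) ∷ cs)
  #Sat-retarget y {z} {z′} cs z∉ z′∉ = trans
    (∑Perm-cong n (λ v _ → 𝟙-cong (satisfies? v ((y , z) ∷ cs)) (satisfies? (compose t v id) ((y , z′) ∷ cs)) (to v) (from v)))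
    (∑Perm-compose t id t-inv (λ _ → refl) (λ v → 𝟙 (satisfies? v ((y , z′) ∷ cs))))
    where
    t = transpose z z′
    t-inv = transpose-involutive z z′
    fix : ∀ {w} → w ∈ cod cs → t w ≡ w
    fix w∈ = transpose-other z z′ (λ w≡z → z∉ (subst (_∈ cod cs) w≡z w∈)) (λ w≡z′ → z′∉ (subst (_∈ cod cs) w≡z′ w∈))
    to : ∀ v → Satisfies v ((y , z) ∷ cs) → Satisfies (compose t v id) ((y , z′) ∷ cs)
    to v sat = subst (λ w → Satisfies (compose t v id) ((y , w) ∷ cs)) (transpose-matchˡ z z′)
                     (satisfies-postcompose-∷ t v y z cs fix sat)
    from : ∀ v → Satisfies (compose t v id) ((y , z′) ∷ cs) → Satisfies v ((y , z) ∷ cs)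
    from v sat = subst₂ (λ u w → Satisfies u ((y , w) ∷ cs)) (compose-involutive t id t-inv (λ _ → refl) v) (transpose-matchʳ z z′)
                        (satisfies-postcompose-∷ t (compose t v id) y z′ cs fix sat)

  #∉ : ∀ L → Unique L → ∑ (allFin n) (λ z → 𝟙 (z ∉? L)) ≡ n ∸ length L
  #∉ L uniq = begin
    ∑ (allFin n) (λ z → 𝟙 (z ∉? L))                         ≡⟨ sym (m+n∸n≡m _ (length L)) ⟩
    ∑ (allFin n) (λ z → 𝟙 (z ∉? L)) + length L ∸ length L   ≡⟨ cong (_∸ length L) (OverFin.∑-∉ L uniq) ⟩
    length (allFin n) ∸ length L                            ≡⟨ cong (_∸ length L) (length-tabulate id) ⟩
    n ∸ length L                                            ∎
    where open ≡-Reasoning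

  𝟙-satisfies≡∑-images : ∀ v → IsPermutation v → ∀ y cs → y ∉ dom cs →
    𝟙 (satisfies? v cs) ≡ ∑ (allFin n) (λ z′ → 𝟙 (z′ ∉? cod cs) * 𝟙 (satisfies? v ((y , z′) ∷ cs)))
  𝟙-satisfies≡∑-images v inj y cs y∉ = sym (begin
    ∑ (allFin n) (λ z′ → 𝟙 (z′ ∉? cod cs) * 𝟙 (satisfies? v ((y , z′) ∷ cs)))
      ≡⟨ ∑-cong (allFin n) (λ z′ → cong (𝟙 (z′ ∉? cod cs) *_) (𝟙-satisfies-∷ v y z′ cs)) ⟩
    ∑ (allFin n) (λ z′ → 𝟙 (z′ ∉? cod cs) * (𝟙 (lookup v y Fin.≟ z′) * 𝟙 (satisfies? v cs)))
      ≡⟨ ∑-cong (allFin n) (λ z′ → *-CS.x∙yz≈y∙xz (𝟙 (z′ ∉? cod cs)) (𝟙 (lookup v y Fin.≟ z′)) (𝟙 (satisfies? v cs))) ⟩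
    ∑ (allFin n) (λ z′ → 𝟙 (lookup v y Fin.≟ z′) * (𝟙 (z′ ∉? cod cs) * 𝟙 (satisfies? v cs)))
      ≡⟨ OverFin.∑-δ′ (lookup v y) _ ⟩
    𝟙 (lookup v y ∉? cod cs) * 𝟙 (satisfies? v cs)
      ≡⟨ image-free (satisfies? v cs) ⟩
    𝟙 (satisfies? v cs) ∎)
    where
    open ≡-Reasoning
    image-free : (d : Dec (Satisfies v cs)) → 𝟙 (lookup v y ∉? cod cs) * 𝟙 d ≡ 𝟙 d
    image-free (yes sat) = cong (_* 1) (𝟙-yes (lookup v y ∉? cod cs) (cod-avoids v inj cs sat y∉))
    image-free (no  _)   = *-zeroʳ (𝟙 (lookup v y ∉? cod cs))

  #Sat-extend : ∀ y z cs → y ∉ dom cs → z ∉ cod cs → Unique (cod cs) → #Sat ((y , z) ∷ cs) * (n ∸ length cs) ≡ #Sat cs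
  #Sat-extend y z cs y∉ z∉ uniq = sym (begin
    ∑Perm n (λ v → 𝟙 (satisfies? v cs))
      ≡⟨ ∑Perm-cong n (λ v inj → 𝟙-satisfies≡∑-images v inj y cs y∉) ⟩
    ∑Perm n (λ v → ∑ (allFin n) (λ z′ → 𝟙 (z′ ∉? cod cs) * 𝟙 (satisfies? v ((y , z′) ∷ cs))))
      ≡⟨ ∑Perm-comm n (allFin n) _ ⟩
    ∑ (allFin n) (λ z′ → ∑Perm n (λ v → 𝟙 (z′ ∉? cod cs) * 𝟙 (satisfies? v ((y , z′) ∷ cs))))
      ≡⟨ ∑-cong (allFin n) (λ z′ → ∑Perm-*ˡ n (𝟙 (z′ ∉? cod cs)) _) ⟩
    ∑ (allFin n) (λ z′ → 𝟙 (z′ ∉? cod cs) * #Sat ((y , z′) ∷ cs))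
      ≡⟨ ∑-cong (allFin n) (λ z′ → 𝟙*-cong (z′ ∉? cod cs) (λ z′∉ → #Sat-retarget y cs z′∉ z∉)) ⟩
    ∑ (allFin n) (λ z′ → 𝟙 (z′ ∉? cod cs) * #Sat ((y , z) ∷ cs))
      ≡⟨ ∑-*ʳ (allFin n) _ _ ⟩
    ∑ (allFin n) (λ z′ → 𝟙 (z′ ∉? cod cs)) * #Sat ((y , z) ∷ cs)
      ≡⟨ cong (_* #Sat ((y , z) ∷ cs)) (trans (#∉ (cod cs) uniq) (cong (n ∸_) (length-map proj₂ cs))) ⟩
    (n ∸ length cs) * #Sat ((y , z) ∷ cs)
      ≡⟨ *-comm (n ∸ length cs) _ ⟩
    #Sat ((y , z) ∷ cs) * (n ∸ length cs) ∎)
    where open ≡-Reasoning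

  #Sat-*-P′ : ∀ cs → Valid cs → #Sat cs * (n P′ length cs) ≡ #Sat []
  #Sat-*-P′ []             _ = *-identityʳ (#Sat [])
  #Sat-*-P′ ((y , z) ∷ cs) (udom@(_ ∷ udom′) , ucod@(_ ∷ ucod′)) = begin
    #Sat ((y , z) ∷ cs) * ((n ∸ length cs) * (n P′ length cs)) ≡⟨ sym (*-assoc (#Sat ((y , z) ∷ cs)) _ _) ⟩
    #Sat ((y , z) ∷ cs) * (n ∸ length cs) * (n P′ length cs)   ≡⟨ cong (_* (n P′ length cs)) (#Sat-extend y z cs
                                                                     (Unique[x∷xs]⇒x∉xs udom) (Unique[x∷xs]⇒x∉xs ucod) ucod′) ⟩
    #Sat cs * (n P′ length cs)                                 ≡⟨ #Sat-*-P′ cs (udom′ , ucod′) ⟩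
    #Sat []                                                    ∎
    where open ≡-Reasoning

  identity : Vec (Fin n) n
  identity = tabulateᵥ id

  fixed-points : Constraints n
  fixed-points = map (λ i → (i , i)) (allFin n)

  fixed-points-valid : Valid fixed-points
  fixed-points-valid = subst Unique (sym dom≡allFin) (allFin⁺ n) , subst Unique (sym cod≡allFin) (allFin⁺ n)
    where
    dom≡allFin : dom fixed-points ≡ allFin n
    dom≡allFin = trans (sym (map-∘ (allFin n))) (map-id (allFin n))
    cod≡allFin : cod fixed-points ≡ allFin n
    cod≡allFin = trans (sym (map-∘ (allFin n))) (map-id (allFin n))

  #Sat-fixed-points : #Sat fixed-points ≡ 1
  #Sat-fixed-points = begin
    ∑ (allVecs n n) (λ v → 𝟙 (isPermutation? v) * 𝟙 (satisfies? v fixed-points))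
      ≡⟨ ∑-cong (allVecs n n) only-identity ⟩
    ∑ (allVecs n n) (λ v → 𝟙 (≡-dec Fin._≟_ v identity) * 1)
      ≡⟨ OverVec.∑-δ identity (const 1) ⟩
    1 ∎
    where
    open ≡-Reasoning
    only-identity : ∀ v → 𝟙 (isPermutation? v) * 𝟙 (satisfies? v fixed-points) ≡ 𝟙 (≡-dec Fin._≟_ v identity) * 1
    only-identity v = begin
      𝟙 (isPermutation? v) * 𝟙 (satisfies? v fixed-points)  ≡⟨ sym (𝟙-× (isPermutation? v) (satisfies? v fixed-points) (isPermutation? v ×-dec satisfies? v fixed-points)) ⟩
      𝟙 (isPermutation? v ×-dec satisfies? v fixed-points) ≡⟨ 𝟙-cong (isPermutation? v ×-dec satisfies? v fixed-points) (≡-dec Fin._≟_ v identity) to from ⟩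
      𝟙 (≡-dec Fin._≟_ v identity)                        ≡⟨ sym (*-identityʳ _) ⟩
      𝟙 (≡-dec Fin._≟_ v identity) * 1                    ∎
      where
      to : IsPermutation v × Satisfies v fixed-points → v ≡ identity
      to (_ , sat) = trans (sym (tabulate∘lookup v)) (tabulate-cong (All-tabulate⁻ (All-map⁻ sat)))
      from : v ≡ identity → IsPermutation v × Satisfies v fixed-points
      from refl = (λ eq → trans (sym (lookup∘tabulate id _)) (trans eq (lookup∘tabulate id _)))
                , All-map⁺ (All-tabulate⁺ (lookup∘tabulate id))

  #Perm : ∑Perm n (const 1) ≡ n !
  #Perm = begin
    #Sat []                                        ≡⟨ sym (#Sat-*-P′ fixed-points fixed-points-valid) ⟩
    #Sat fixed-points * (n P′ length fixed-points) ≡⟨ cong₂ (λ a k → a * (n P′ k)) #Sat-fixed-points length-fixed-points ⟩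
    1 * (n P′ n)                                   ≡⟨ *-identityˡ (n P′ n) ⟩
    n P′ n                                         ≡⟨ sym (*-identityʳ (n P′ n)) ⟩
    (n P′ n) * 1                                   ≡⟨ cong (λ k → (n P′ n) * k !) (sym (n∸n≡0 n)) ⟩
    (n P′ n) * (n ∸ n) !                           ≡⟨ nP′k*[n∸k]!≡n! n n ≤-refl ⟩
    n !                                            ∎
    where
    open ≡-Reasoning
    length-fixed-points : length fixed-points ≡ n
    length-fixed-points = trans (length-map _ (allFin n)) (length-tabulate id)

  #Sat-valid : ∀ cs → Valid cs → length cs ≤ n → #Sat cs ≡ (n ∸ length cs) !
  #Sat-valid cs valid k≤n = *-cancelʳ-≡ (#Sat cs) ((n ∸ k) !) (n P′ k) {{nP′k≢0 n k k≤n}} (begin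
    #Sat cs * (n P′ k)     ≡⟨ #Sat-*-P′ cs valid ⟩
    #Sat []                ≡⟨ #Perm ⟩
    n !                    ≡⟨ sym (nP′k*[n∸k]!≡n! n k k≤n) ⟩
    (n P′ k) * (n ∸ k) !   ≡⟨ *-comm (n P′ k) _ ⟩
    (n ∸ k) ! * (n P′ k)   ∎)
    where
    open ≡-Reasoning
    k = length cs

  𝟙-unique-∷ : ∀ (z : Fin n) L → 𝟙 (unique? (z ∷ L)) ≡ 𝟙 (z ∉? L) * 𝟙 (unique? L)
  𝟙-unique-∷ z L = trans (𝟙-× z≢? (unique? L) (z≢? ×-dec unique? L))
                         (cong (_* 𝟙 (unique? L)) (𝟙-cong z≢? (z ∉? L) All¬⇒¬Any (¬Any⇒All¬ L)))
    where
    z≢? = all? (λ y → ¬? (z Fin.≟ y)) L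

  #unique-prefixes : ∀ S m → ∑ (allVecs n m) (λ x → 𝟙 (unique? (toList x ++ S))) ≡ 𝟙 (unique? S) * ((n ∸ length S) P′ m)
  #unique-prefixes S zero    = trans (+-identityʳ _) (sym (*-identityʳ _))
  #unique-prefixes S (suc m) = begin
    ∑ (allVecs n (suc m)) (λ x → 𝟙 (unique? (toList x ++ S)))
      ≡⟨ ∑-allVecs-suc n m _ ⟩
    ∑ (allVecs n m) (λ x → ∑ (allFin n) (λ z → 𝟙 (unique? (z ∷ toList x ++ S))))
      ≡⟨ ∑-cong (allVecs n m) (λ x → ∑-cong (allFin n) (λ z → 𝟙-unique-∷ z (toList x ++ S))) ⟩
    ∑ (allVecs n m) (λ x → ∑ (allFin n) (λ z → 𝟙 (z ∉? toList x ++ S) * 𝟙 (unique? (toList x ++ S))))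
      ≡⟨ ∑-cong (allVecs n m) (λ x → trans (∑-*ʳ (allFin n) _ _) (free-heads x)) ⟩
    ∑ (allVecs n m) (λ x → 𝟙 (unique? (toList x ++ S)) * (n ∸ length S ∸ m))
      ≡⟨ ∑-*ʳ (allVecs n m) _ _ ⟩
    ∑ (allVecs n m) (λ x → 𝟙 (unique? (toList x ++ S))) * (n ∸ length S ∸ m)
      ≡⟨ cong (_* (n ∸ length S ∸ m)) (#unique-prefixes S m) ⟩
    𝟙 (unique? S) * ((n ∸ length S) P′ m) * (n ∸ length S ∸ m)
      ≡⟨ *-CS.xy∙z≈x∙zy (𝟙 (unique? S)) _ _ ⟩
    𝟙 (unique? S) * ((n ∸ length S ∸ m) * ((n ∸ length S) P′ m)) ∎
    where
    open ≡-Reasoning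
    free-heads : ∀ x → ∑ (allFin n) (λ z → 𝟙 (z ∉? toList x ++ S)) * 𝟙 (unique? (toList x ++ S))
                     ≡ 𝟙 (unique? (toList x ++ S)) * (n ∸ length S ∸ m)
    free-heads x = trans (*-comm _ (𝟙 (unique? (toList x ++ S)))) (𝟙*-cong (unique? (toList x ++ S)) (λ uniq → begin
      ∑ (allFin n) (λ z → 𝟙 (z ∉? toList x ++ S)) ≡⟨ #∉ (toList x ++ S) uniq ⟩
      n ∸ length (toList x ++ S)                  ≡⟨ cong (n ∸_) (trans (length-++ (toList x)) (cong (_+ length S) (length-toList x))) ⟩
      n ∸ (m + length S)                          ≡⟨ cong (n ∸_) (+-comm m (length S)) ⟩
      n ∸ (length S + m)                          ≡⟨ sym (∸-+-assoc n (length S) m) ⟩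
      n ∸ length S ∸ m                            ∎))

-- Cycles

module _ {n : ℕ} where

  orbit : (Fin n → Fin n) → Fin n → (m : ℕ) → Vec (Fin n) m
  orbit f p zero    = []ᵥ
  orbit f p (suc m) = f p ∷ᵥ orbit f (f p) m

  module _ (f : Fin n → Fin n) where

    orbit-∈⁻ : ∀ p m {y} → y ∈ toList (orbit f p m) → Σ ℕ λ j → j < m × y ≡ iter f (suc j) p
    orbit-∈⁻ p (suc m) (here y≡fp) = 0 , s≤s z≤n , y≡fp
    orbit-∈⁻ p (suc m) (there y∈)  with orbit-∈⁻ (f p) m y∈
    ... | j , j<m , y≡ = suc j , s≤s j<m , trans y≡ (sym (iter-sucʳ f (suc j) p))

    orbit-∈⁺ : ∀ p m {j} → j < m → iter f (suc j) p ∈ toList (orbit f p m)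
    orbit-∈⁺ p (suc m) {zero}  _          = here refl
    orbit-∈⁺ p (suc m) {suc j} (s≤s j<m) =
      there (subst (_∈ toList (orbit f (f p) m)) (sym (iter-sucʳ f (suc j) p)) (orbit-∈⁺ (f p) m j<m))

    -- `a` lies on a cycle of `f` of length `suc m`; the word `orbit f a m` lists f a, …, fᵐ a.
    OnCycle : Fin n → ℕ → Set
    OnCycle a m = Unique (toList (orbit f a m) ++ a ∷ []) × iter f (suc m) a ≡ a

    onCycle? : ∀ a m → Dec (OnCycle a m)
    onCycle? a m = unique? (toList (orbit f a m) ++ a ∷ []) ×-dec (iter f (suc m) a Fin.≟ a)

    module _ {a : Fin n} {m : ℕ} (cycle : OnCycle a m) where

      onCycle-no-earlier-return : ∀ {j} → j < m → iter f (suc j) a ≢ a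
      onCycle-no-earlier-return j<m returns = Unique[xs∷ʳx]⇒x∉xs (toList (orbit f a m)) (proj₁ cycle)
        (subst (_∈ toList (orbit f a m)) returns (orbit-∈⁺ a m j<m))

      onCycle-periodic : ∀ {k} → suc m ∣ k → iter f k a ≡ a
      onCycle-periodic (divides q refl) = iter-periodic f (suc m) q (proj₂ cycle)

      iter-mod : ∀ j → iter f j a ≡ iter f (j % suc m) a
      iter-mod j = begin
        iter f j a                                          ≡⟨ cong (λ t → iter f t a) (m≡m%n+[m/n]*n j (suc m)) ⟩
        iter f (j % suc m + j / suc m * suc m) a            ≡⟨ iter-+ f (j % suc m) _ a ⟩
        iter f (j % suc m) (iter f (j / suc m * suc m) a)   ≡⟨ cong (iter f (j % suc m)) (onCycle-periodic (divides (j / suc m) refl)) ⟩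
        iter f (j % suc m) a                                ∎
        where open ≡-Reasoning

      onCycle-∣ : ∀ {j} → iter f j a ≡ a → suc m ∣ j
      onCycle-∣ {j} returns = m%n≡0⇒n∣m j (suc m) (no-remainder (j % suc m) refl (m%n<n j (suc m)))
        where
        no-remainder : ∀ r → j % suc m ≡ r → r < suc m → j % suc m ≡ 0
        no-remainder zero    j%≡0 _         = j%≡0
        no-remainder (suc r) j%≡r (s≤s r<m) = ⊥-elim (onCycle-no-earlier-return r<m
          (subst (λ t → iter f t a ≡ a) j%≡r (trans (sym (iter-mod j)) returns)))

      onCycle-closed : ∀ j → iter f j a ∈ toList (orbit f a m) ++ a ∷ []
      onCycle-closed j = subst (_∈ toList (orbit f a m) ++ a ∷ []) (sym (iter-mod j)) (early (j % suc m) (m%n<n j (suc m)))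
        where
        early : ∀ r → r < suc m → iter f r a ∈ toList (orbit f a m) ++ a ∷ []
        early zero    _         = ∈-++⁺ʳ (toList (orbit f a m)) (here refl)
        early (suc r) (s≤s r<m) = ∈-++⁺ˡ (orbit-∈⁺ a m r<m)

    orbit-fixed : ∀ {a m k y} → OnCycle a m → suc m ∣ k → y ∈ toList (orbit f a m) → iter f k y ≡ y
    orbit-fixed {a} {m} {k} {y} cycle m+1∣k y∈ with orbit-∈⁻ a m y∈
    ... | j , _ , y≡ = begin
      iter f k y                    ≡⟨ cong (iter f k) y≡ ⟩
      iter f k (iter f (suc j) a)   ≡⟨ iter-comm f k (suc j) a ⟩
      iter f (suc j) (iter f k a)   ≡⟨ cong (iter f (suc j)) (onCycle-periodic cycle m+1∣k) ⟩
      iter f (suc j) a              ≡⟨ sym y≡ ⟩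
      y                             ∎
      where open ≡-Reasoning

    cycle-∈⁻ : ∀ a m {y} → y ∈ toList (orbit f a m) ++ a ∷ [] → Σ ℕ λ i → y ≡ iter f i a
    cycle-∈⁻ a m y∈ with ∈-++⁻ (toList (orbit f a m)) y∈
    ... | inj₁ y∈orbit      = let (j , _ , y≡) = orbit-∈⁻ a m y∈orbit in suc j , y≡
    ... | inj₂ (here y≡a)   = 0 , y≡a

    onCycle-unique : ∀ {a m m′} → OnCycle a m → OnCycle a m′ → m ≡ m′
    onCycle-unique c c′ = suc-injective (∣-antisym (onCycle-∣ c (proj₂ c′)) (onCycle-∣ c′ (proj₂ c)))

    module _ (f-inj : Injective _≡_ _≡_ f) {a : Fin n} {M : ℕ} (no-return : ∀ j → j < M → iter f (suc j) a ≢ a) where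

      orbit-unique-before-return : ∀ s m → s + m ≤ M → Unique (toList (orbit f (iter f s a) m) ++ a ∷ [])
      orbit-unique-before-return s zero    _     = [] ∷ []
      orbit-unique-before-return s (suc m) s+m<M =
        ¬Any⇒All¬ _ head-new ∷ orbit-unique-before-return (suc s) m (subst (_≤ M) (+-suc s m) s+m<M)
        where
        s+m<M′ : suc (s + m) ≤ M
        s+m<M′ = subst (_≤ M) (+-suc s m) s+m<M
        head-new : iter f (suc s) a ∉ toList (orbit f (iter f (suc s) a) m) ++ a ∷ []
        head-new h∈ with ∈-++⁻ (toList (orbit f (iter f (suc s) a) m)) h∈
        ... | inj₂ (here returns) = no-return s (≤-trans (s≤s (m≤m+n s m)) s+m<M′) returns
        ... | inj₁ h∈orbit with orbit-∈⁻ (iter f (suc s) a) m h∈orbit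
        ...   | j , j<m , h≡ = no-return j (<-≤-trans j<m (≤-trans (m≤n+m m (suc s)) s+m<M′))
                  (sym (iter-injective f-inj (suc s) (trans h≡ (iter-comm f (suc j) (suc s) a))))

    onCycle-exists : Injective _≡_ _≡_ f → ∀ {a} k → iter f (suc k) a ≡ a → Σ ℕ λ m → m ≤ k × OnCycle a m
    onCycle-exists f-inj {a} k returns with least (λ d → iter f (suc d) a Fin.≟ a) (suc k)
    ... | inj₁ (m , m<1+k , returns-at-m , below) = m , ≤-pred m<1+k , orbit-unique-before-return f-inj below 0 m ≤-refl , returns-at-m
    ... | inj₂ none = ⊥-elim (none k ≤-refl returns)

    𝟙-iter-fixed : Injective _≡_ _≡_ f → ∀ a k →
      𝟙 (iter f (suc k) a Fin.≟ a) ≡ ∑ (upTo (suc k)) (λ m → 𝟙 (suc m ∣? suc k) * 𝟙 (onCycle? a m))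
    𝟙-iter-fixed f-inj a k = trans (count (iter f (suc k) a Fin.≟ a))
      (∑-cong (upTo (suc k)) (λ m → 𝟙-× (suc m ∣? suc k) (onCycle? a m) ((suc m ∣? suc k) ×-dec onCycle? a m)))
      where
      count : (d : Dec (iter f (suc k) a ≡ a)) → 𝟙 d ≡ ∑ (upTo (suc k)) (λ m → 𝟙 ((suc m ∣? suc k) ×-dec onCycle? a m))
      count (yes returns) with onCycle-exists f-inj k returns
      ... | m₀ , m₀≤k , cycle = sym (∑-upTo-unique (λ m → (suc m ∣? suc k) ×-dec onCycle? a m) (suc k) (s≤s m₀≤k)
                                    (onCycle-∣ cycle returns , cycle) (λ (_ , cycle′) → onCycle-unique cycle′ cycle))
      count (no ¬returns) = sym (∑-upTo-none (λ m → (suc m ∣? suc k) ×-dec onCycle? a m) (suc k)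
                                  (λ m (m+1∣ , cycle) → ¬returns (onCycle-periodic cycle m+1∣)))

module _ {n : ℕ} where

  path : ∀ {m} → Fin n → Vec (Fin n) m → Fin n → Constraints n
  path p []ᵥ       q = (p , q) ∷ []
  path p (x ∷ᵥ xs) q = (p , x) ∷ path x xs q

  dom-path : ∀ {m} p (x : Vec (Fin n) m) q → dom (path p x q) ≡ p ∷ toList x
  dom-path p []ᵥ       q = refl
  dom-path p (x ∷ᵥ xs) q = cong (p ∷_) (dom-path x xs q)

  cod-path : ∀ {m} p (x : Vec (Fin n) m) q → cod (path p x q) ≡ toList x ++ q ∷ []
  cod-path p []ᵥ       q = refl
  cod-path p (x ∷ᵥ xs) q = cong (x ∷_) (cod-path x xs q)

  length-path : ∀ {m} p (x : Vec (Fin n) m) q → length (path p x q) ≡ suc m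
  length-path p []ᵥ       q = refl
  length-path p (x ∷ᵥ xs) q = cong suc (length-path x xs q)

  cycle-valid : ∀ {m} a (x : Vec (Fin n) m) → Unique (toList x ++ a ∷ []) → Valid (path a x a)
  cycle-valid a x uniq = subst Unique (sym (dom-path a x a)) (Unique-rotate (toList x) uniq)
                       , subst Unique (sym (cod-path a x a)) uniq

  module _ (v : Vec (Fin n) n) where

    satisfies-path⁻ : ∀ p {m} (x : Vec (Fin n) m) q → Satisfies v (path p x q) →
      x ≡ orbit (lookup v) p m × iter (lookup v) (suc m) p ≡ q
    satisfies-path⁻ p []ᵥ q (vp≡q ∷ []) = refl , vp≡q
    satisfies-path⁻ p {suc m} (x ∷ᵥ xs) q (refl ∷ sat) with satisfies-path⁻ (lookup v p) xs q sat
    ... | xs≡ , returns = cong (lookup v p ∷ᵥ_) xs≡ , trans (iter-sucʳ (lookup v) (suc m) p) returns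

    satisfies-path⁺ : ∀ p m q → iter (lookup v) (suc m) p ≡ q → Satisfies v (path p (orbit (lookup v) p m) q)
    satisfies-path⁺ p zero    q returns = returns ∷ []
    satisfies-path⁺ p (suc m) q returns =
      refl ∷ satisfies-path⁺ (lookup v p) m q (trans (sym (iter-sucʳ (lookup v) (suc m) p)) returns)

    ∑-path : ∀ p m q (g : Vec (Fin n) m → ℕ) →
      ∑ (allVecs n m) (λ x → g x * 𝟙 (satisfies? v (path p x q)))
        ≡ g (orbit (lookup v) p m) * 𝟙 (iter (lookup v) (suc m) p Fin.≟ q)
    ∑-path p m q g = begin
      ∑ (allVecs n m) (λ x → g x * 𝟙 (satisfies? v (path p x q)))
        ≡⟨ ∑-cong (allVecs n m) (λ x → cong (g x *_) (trans
             (𝟙-cong (satisfies? v (path p x q)) (≡-dec Fin._≟_ x o ×-dec returns?) (satisfies-path⁻ p x q)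
                     (λ { (refl , returns) → satisfies-path⁺ p m q returns }))
             (𝟙-× (≡-dec Fin._≟_ x o) returns? (≡-dec Fin._≟_ x o ×-dec returns?)))) ⟩
      ∑ (allVecs n m) (λ x → g x * (𝟙 (≡-dec Fin._≟_ x o) * 𝟙 returns?))
        ≡⟨ ∑-cong (allVecs n m) (λ x → *-CS.x∙yz≈y∙xz (g x) (𝟙 (≡-dec Fin._≟_ x o)) (𝟙 returns?)) ⟩
      ∑ (allVecs n m) (λ x → 𝟙 (≡-dec Fin._≟_ x o) * (g x * 𝟙 returns?))
        ≡⟨ OverVec.∑-δ o (λ x → g x * 𝟙 returns?) ⟩
      g o * 𝟙 returns? ∎
      where
      open ≡-Reasoning
      o = orbit (lookup v) p m
      returns? = iter (lookup v) (suc m) p Fin.≟ q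

  ∑Perm-onCycle : ∀ a {m} → m < n → (h : Vec (Fin n) m → ℕ) →
    ∑Perm n (λ v → 𝟙 (onCycle? (lookup v) a m) * h (orbit (lookup v) a m))
      ≡ ∑ (allVecs n m) (λ x → 𝟙 (unique? (toList x ++ a ∷ [])) * h x) * (n ∸ suc m) !
  ∑Perm-onCycle a {m} m<n h = begin
    ∑Perm n (λ v → 𝟙 (onCycle? (lookup v) a m) * h (orbit (lookup v) a m))
      ≡⟨ ∑Perm-cong n (λ v _ → sym (trans (∑-path v a m a g) (split v))) ⟩
    ∑Perm n (λ v → ∑ (allVecs n m) (λ x → g x * 𝟙 (satisfies? v (path a x a))))
      ≡⟨ ∑Perm-comm n (allVecs n m) _ ⟩
    ∑ (allVecs n m) (λ x → ∑Perm n (λ v → g x * 𝟙 (satisfies? v (path a x a))))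
      ≡⟨ ∑-cong (allVecs n m) (λ x → trans (∑Perm-*ˡ n (g x) _) (*-assoc (𝟙 (unique? (toList x ++ a ∷ []))) (h x) _)) ⟩
    ∑ (allVecs n m) (λ x → 𝟙 (unique? (toList x ++ a ∷ [])) * (h x * #Sat (path a x a)))
      ≡⟨ ∑-cong (allVecs n m) (λ x → 𝟙*-cong (unique? (toList x ++ a ∷ [])) (λ uniq → cong (h x *_) (#Sat-cycle x uniq))) ⟩
    ∑ (allVecs n m) (λ x → 𝟙 (unique? (toList x ++ a ∷ [])) * (h x * (n ∸ suc m) !))
      ≡⟨ ∑-cong (allVecs n m) (λ x → sym (*-assoc (𝟙 (unique? (toList x ++ a ∷ []))) (h x) _)) ⟩
    ∑ (allVecs n m) (λ x → g x * (n ∸ suc m) !)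
      ≡⟨ ∑-*ʳ (allVecs n m) _ g ⟩
    ∑ (allVecs n m) g * (n ∸ suc m) ! ∎
    where
    open ≡-Reasoning
    g : Vec (Fin n) m → ℕ
    g x = 𝟙 (unique? (toList x ++ a ∷ [])) * h x
    split : ∀ v → g (orbit (lookup v) a m) * 𝟙 (iter (lookup v) (suc m) a Fin.≟ a)
                  ≡ 𝟙 (onCycle? (lookup v) a m) * h (orbit (lookup v) a m)
    split v = trans (*-CS.xy∙z≈xz∙y (𝟙 (unique? (toList o ++ a ∷ []))) (h o) _)
                    (cong (_* h o) (sym (𝟙-× (unique? (toList o ++ a ∷ [])) (iter (lookup v) (suc m) a Fin.≟ a) (onCycle? (lookup v) a m))))
      where o = orbit (lookup v) a m
    #Sat-cycle : ∀ x → Unique (toList x ++ a ∷ []) → #Sat (path a x a) ≡ (n ∸ suc m) !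
    #Sat-cycle x uniq = trans (#Sat-valid (path a x a) (cycle-valid a x uniq) (subst (_≤ n) (sym (length-path a x a)) m<n))
                              (cong (λ k → (n ∸ k) !) (length-path a x a))

  #onCycle : ∀ a m → m < n → ∑Perm n (λ v → 𝟙 (onCycle? (lookup v) a m)) ≡ (n ∸ 1) !
  #onCycle a m m<n = begin
    ∑Perm n (λ v → 𝟙 (onCycle? (lookup v) a m))
      ≡⟨ ∑Perm-cong n (λ v _ → sym (*-identityʳ _)) ⟩
    ∑Perm n (λ v → 𝟙 (onCycle? (lookup v) a m) * 1)
      ≡⟨ ∑Perm-onCycle a m<n (const 1) ⟩
    ∑ (allVecs n m) (λ x → 𝟙 (unique? (toList x ++ a ∷ [])) * 1) * (n ∸ suc m) !
      ≡⟨ cong₂ (λ c k → c * k !) (trans (∑-cong (allVecs n m) (λ x → *-identityʳ _)) (#unique-prefixes (a ∷ []) m))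
                                 (sym (∸-+-assoc n 1 m)) ⟩
    1 * ((n ∸ 1) P′ m) * (n ∸ 1 ∸ m) !
      ≡⟨ cong (_* (n ∸ 1 ∸ m) !) (*-identityˡ ((n ∸ 1) P′ m)) ⟩
    ((n ∸ 1) P′ m) * (n ∸ 1 ∸ m) !
      ≡⟨ nP′k*[n∸k]!≡n! (n ∸ 1) m (m+n≤o⇒m≤o∸n m (subst (_≤ n) (+-comm 1 m) m<n)) ⟩
    (n ∸ 1) ! ∎
    where open ≡-Reasoning

  #power-fixes : ∀ a k → suc k ≤ n → ∑Perm n (λ v → 𝟙 (iter (lookup v) (suc k) a Fin.≟ a)) ≡ τ (suc k) * (n ∸ 1) !
  #power-fixes a k k<n = begin
    ∑Perm n (λ v → 𝟙 (iter (lookup v) (suc k) a Fin.≟ a))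
      ≡⟨ ∑Perm-cong n (λ v inj → 𝟙-iter-fixed (lookup v) inj a k) ⟩
    ∑Perm n (λ v → ∑ (upTo (suc k)) (λ m → 𝟙 (suc m ∣? suc k) * 𝟙 (onCycle? (lookup v) a m)))
      ≡⟨ ∑Perm-comm n (upTo (suc k)) _ ⟩
    ∑ (upTo (suc k)) (λ m → ∑Perm n (λ v → 𝟙 (suc m ∣? suc k) * 𝟙 (onCycle? (lookup v) a m)))
      ≡⟨ ∑-cong (upTo (suc k)) (λ m → ∑Perm-*ˡ n (𝟙 (suc m ∣? suc k)) _) ⟩
    ∑ (upTo (suc k)) (λ m → 𝟙 (suc m ∣? suc k) * ∑Perm n (λ v → 𝟙 (onCycle? (lookup v) a m)))
      ≡⟨ ∑-divisors-const (suc k) _ (λ m m+1∣ → #onCycle a m (≤-trans (∣⇒≤ m+1∣) k<n)) ⟩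
    τ (suc k) * (n ∸ 1) ! ∎
    where open ≡-Reasoning

-- Powers fixing or swapping two points

module _ {n : ℕ} (f : Fin n → Fin n) {a b : Fin n} {m m′ : ℕ} where

  disjoint-cycles : OnCycle f a m → OnCycle f b m′ → b ∉ toList (orbit f a m) ++ a ∷ [] →
    Unique (toList (orbit f b m′) ++ b ∷ toList (orbit f a m) ++ a ∷ [])
  disjoint-cycles a-cycle b-cycle b∉ = Unique-++⁺ (proj₁ (Unique-++⁻ (toList (orbit f b m′)) (proj₁ b-cycle)))
                                                  (¬Any⇒All¬ _ b∉ ∷ proj₁ a-cycle) disjoint
    where
    disjoint : ∀ {w} → ¬ (w ∈ toList (orbit f b m′) × w ∈ b ∷ toList (orbit f a m) ++ a ∷ [])
    disjoint (w∈ , w∉) with orbit-∈⁻ f b m′ w∈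
    disjoint (w∈ , here w≡b)    | j , j<m′ , w≡ = onCycle-no-earlier-return f b-cycle j<m′ (trans (sym w≡) w≡b)
    disjoint (w∈ , there w∈cyc) | j , j<m′ , w≡ with cycle-∈⁻ f a m w∈cyc
    ... | i , w≡fⁱa = b∉ (subst (_∈ toList (orbit f a m) ++ a ∷ []) returns-to-b (onCycle-closed f a-cycle (m′ ∸ j + i)))
      where
      returns-to-b : iter f (m′ ∸ j + i) a ≡ b
      returns-to-b = begin
        iter f (m′ ∸ j + i) a              ≡⟨ iter-+ f (m′ ∸ j) i a ⟩
        iter f (m′ ∸ j) (iter f i a)       ≡⟨ cong (iter f (m′ ∸ j)) (trans (sym w≡fⁱa) w≡) ⟩
        iter f (m′ ∸ j) (iter f (suc j) b) ≡⟨ sym (iter-+ f (m′ ∸ j) (suc j) b) ⟩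
        iter f (m′ ∸ j + suc j) b          ≡⟨ cong (λ t → iter f t b) (trans (+-suc (m′ ∸ j) j) (cong suc (m∸n+n≡m (<⇒≤ j<m′)))) ⟩
        iter f (suc m′) b                  ≡⟨ proj₂ b-cycle ⟩
        b                                  ∎
        where open ≡-Reasoning

sameCycle-arith : ∀ N m G → m ≤ N → G + N P′ m ≡ suc N P′ m → G * (suc N ∸ m) ! ≡ m * N !
sameCycle-arith N m G m≤N counts = +-cancelʳ-≡ (suc (N ∸ m) * N !) (G * (suc N ∸ m) !) (m * N !) (begin
  G * (suc N ∸ m) ! + suc (N ∸ m) * N !                ≡⟨ cong (G * (suc N ∸ m) ! +_) (sym avoiding-b) ⟩
  G * (suc N ∸ m) ! + (N P′ m) * (suc N ∸ m) !         ≡⟨ sym (*-distribʳ-+ ((suc N ∸ m) !) G (N P′ m)) ⟩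
  (G + N P′ m) * (suc N ∸ m) !                         ≡⟨ cong (_* (suc N ∸ m) !) counts ⟩
  (suc N P′ m) * (suc N ∸ m) !                         ≡⟨ nP′k*[n∸k]!≡n! (suc N) m (m≤n⇒m≤1+n m≤N) ⟩
  suc N * N !                                          ≡⟨ cong (_* N !) (sym (trans (cong (m +_) (sym 1+N∸m)) (m+[n∸m]≡n (m≤n⇒m≤1+n m≤N)))) ⟩
  (m + suc (N ∸ m)) * N !                              ≡⟨ *-distribʳ-+ (N !) m _ ⟩
  m * N ! + suc (N ∸ m) * N !                          ∎)
  where
  open ≡-Reasoning
  1+N∸m : suc N ∸ m ≡ suc (N ∸ m)
  1+N∸m = +-∸-assoc 1 m≤N
  avoiding-b : (N P′ m) * (suc N ∸ m) ! ≡ suc (N ∸ m) * N !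
  avoiding-b = begin
    (N P′ m) * (suc N ∸ m) !                 ≡⟨ cong (λ k → (N P′ m) * k !) 1+N∸m ⟩
    (N P′ m) * (suc (N ∸ m) * (N ∸ m) !)     ≡⟨ *-CS.x∙yz≈y∙xz (N P′ m) (suc (N ∸ m)) ((N ∸ m) !) ⟩
    suc (N ∸ m) * ((N P′ m) * (N ∸ m) !)     ≡⟨ cong (suc (N ∸ m) *_) (nP′k*[n∸k]!≡n! N m m≤N) ⟩
    suc (N ∸ m) * N !                        ∎

-- Sort the permutations whose K-th power fixes `a` and `b` by the length `suc m` of the cycle of `a`, a divisor
-- of K: either `b` lies on that cycle, or on another cycle whose length also divides K.
module TwoPoints {N : ℕ} {a b : Fin (2 + N)} (b≢a : b ≢ a) where

  sameCycle : Vec (Fin (2 + N)) (2 + N) → ℕ → ℕ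
  sameCycle v m = 𝟙 (onCycle? (lookup v) a m) * 𝟙 (b ∈? toList (orbit (lookup v) a m))

  otherCycles : Vec (Fin (2 + N)) (2 + N) → ℕ → ℕ → ℕ
  otherCycles v m m′ = 𝟙 (onCycle? (lookup v) a m) * (𝟙 (b ∉? toList (orbit (lookup v) a m)) * 𝟙 (onCycle? (lookup v) b m′))

  b∉[a] : ∀ xs → b ∉ xs → b ∉ xs ++ a ∷ []
  b∉[a] xs b∉xs b∈ with ∈-++⁻ xs b∈
  ... | inj₁ b∈xs      = b∉xs b∈xs
  ... | inj₂ (here b≡a) = b≢a b≡a

  𝟙-unique-insert : ∀ xs → 𝟙 (unique? (xs ++ b ∷ a ∷ [])) ≡ 𝟙 (b ∉? xs) * 𝟙 (unique? (xs ++ a ∷ []))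
  𝟙-unique-insert xs = begin
    𝟙 (unique? (xs ++ b ∷ a ∷ []))                 ≡⟨ 𝟙-cong (unique? (xs ++ b ∷ a ∷ [])) (unique? (b ∷ xs ++ a ∷ []))
                                                        (Unique-shift xs (a ∷ [])) (Unique-unshift xs (a ∷ [])) ⟩
    𝟙 (unique? (b ∷ xs ++ a ∷ []))                 ≡⟨ 𝟙-unique-∷ b (xs ++ a ∷ []) ⟩
    𝟙 (b ∉? xs ++ a ∷ []) * 𝟙 (unique? (xs ++ a ∷ [])) ≡⟨ cong (_* 𝟙 (unique? (xs ++ a ∷ [])))
                                                          (𝟙-cong (b ∉? xs ++ a ∷ []) (b ∉? xs) (λ b∉ → b∉ ∘ ∈-++⁺ˡ) (b∉[a] xs)) ⟩
    𝟙 (b ∉? xs) * 𝟙 (unique? (xs ++ a ∷ []))        ∎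
    where open ≡-Reasoning

  unique-ba : 𝟙 (unique? (b ∷ a ∷ [])) ≡ 1
  unique-ba = 𝟙-yes (unique? (b ∷ a ∷ [])) (¬Any⇒All¬ _ (b∉[a] [] (λ ())) ∷ [] ∷ [])

  #sameCycle : ∀ m → m ≤ N → ∑Perm (2 + N) (λ v → sameCycle v m) ≡ m * N !
  #sameCycle m m≤N = begin
    ∑Perm (2 + N) (λ v → sameCycle v m)  ≡⟨ ∑Perm-onCycle a (s≤s (m≤n⇒m≤1+n m≤N)) (λ x → 𝟙 (b ∈? toList x)) ⟩
    G * (suc N ∸ m) !                      ≡⟨ sameCycle-arith N m G m≤N G+avoiding ⟩
    m * N !                                ∎
    where
    open ≡-Reasoning
    G = ∑ (allVecs (2 + N) m) (λ x → 𝟙 (unique? (toList x ++ a ∷ [])) * 𝟙 (b ∈? toList x))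
    through-b-or-not : ∀ xs → 𝟙 (unique? (xs ++ a ∷ [])) * 𝟙 (b ∈? xs) + 𝟙 (unique? (xs ++ b ∷ a ∷ [])) ≡ 𝟙 (unique? (xs ++ a ∷ []))
    through-b-or-not xs = begin
      u * 𝟙 (b ∈? xs) + 𝟙 (unique? (xs ++ b ∷ a ∷ [])) ≡⟨ cong (u * 𝟙 (b ∈? xs) +_) (trans (𝟙-unique-insert xs) (*-comm _ u)) ⟩
      u * 𝟙 (b ∈? xs) + u * 𝟙 (b ∉? xs)                 ≡⟨ sym (*-distribˡ-+ u _ _) ⟩
      u * (𝟙 (b ∈? xs) + 𝟙 (b ∉? xs))                   ≡⟨ cong (u *_) (𝟙-¬ (b ∈? xs) (b ∉? xs)) ⟩
      u * 1                                              ≡⟨ *-identityʳ u ⟩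
      u                                                  ∎
      where u = 𝟙 (unique? (xs ++ a ∷ []))
    G+avoiding : G + N P′ m ≡ suc N P′ m
    G+avoiding = begin
      G + N P′ m
        ≡⟨ cong (G +_) (sym (trans (#unique-prefixes (b ∷ a ∷ []) m) (trans (cong (_* (N P′ m)) unique-ba) (*-identityˡ _)))) ⟩
      G + ∑ (allVecs (2 + N) m) (λ x → 𝟙 (unique? (toList x ++ b ∷ a ∷ [])))
        ≡⟨ sym (∑-+ (allVecs (2 + N) m) _ _) ⟩
      ∑ (allVecs (2 + N) m) (λ x → 𝟙 (unique? (toList x ++ a ∷ [])) * 𝟙 (b ∈? toList x) + 𝟙 (unique? (toList x ++ b ∷ a ∷ [])))
        ≡⟨ ∑-cong (allVecs (2 + N) m) (λ x → through-b-or-not (toList x)) ⟩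
      ∑ (allVecs (2 + N) m) (λ x → 𝟙 (unique? (toList x ++ a ∷ [])))
        ≡⟨ trans (#unique-prefixes (a ∷ []) m) (*-identityˡ _) ⟩
      suc N P′ m ∎

  two-cycles-valid : ∀ {m m′} (x : Vec (Fin (2 + N)) m) (y : Vec (Fin (2 + N)) m′) →
    Unique (toList y ++ b ∷ toList x ++ a ∷ []) → Valid (path a x a ++ path b y b)
  two-cycles-valid x y uniq = subst Unique (sym dom≡) (Unique-rotate-++ (toList x) (toList y) cod-unique)
                            , subst Unique (sym cod≡) cod-unique
    where
    cod-unique : Unique ((toList x ++ a ∷ []) ++ (toList y ++ b ∷ []))
    cod-unique = Unique-++-comm (toList y ++ b ∷ []) _ (subst Unique (sym (++-assoc (toList y) (b ∷ []) _)) uniq)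
    dom≡ : dom (path a x a ++ path b y b) ≡ (a ∷ toList x) ++ (b ∷ toList y)
    dom≡ = trans (map-++ proj₁ (path a x a) _) (cong₂ _++_ (dom-path a x a) (dom-path b y b))
    cod≡ : cod (path a x a ++ path b y b) ≡ (toList x ++ a ∷ []) ++ (toList y ++ b ∷ [])
    cod≡ = trans (map-++ proj₂ (path a x a) _) (cong₂ _++_ (cod-path a x a) (cod-path b y b))

  module _ (m m′ : ℕ) where

    twoCycleWords : Vec (Fin (2 + N)) m → Vec (Fin (2 + N)) m′ → ℕ
    twoCycleWords x y = 𝟙 (unique? (toList y ++ b ∷ toList x ++ a ∷ []))

    𝟙-otherCycles : ∀ v → let f = lookup v in
      twoCycleWords (orbit f a m) (orbit f b m′) * 𝟙 (iter f (suc m′) b Fin.≟ b) * 𝟙 (iter f (suc m) a Fin.≟ a)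
        ≡ otherCycles v m m′
    𝟙-otherCycles v = begin
      twoCycleWords ox oy * 𝟙 b-returns? * 𝟙 a-returns?
        ≡⟨ cong (_* 𝟙 a-returns?) (sym (𝟙-× words? b-returns? (words? ×-dec b-returns?))) ⟩
      𝟙 (words? ×-dec b-returns?) * 𝟙 a-returns?
        ≡⟨ sym (𝟙-× (words? ×-dec b-returns?) a-returns? ((words? ×-dec b-returns?) ×-dec a-returns?)) ⟩
      𝟙 ((words? ×-dec b-returns?) ×-dec a-returns?)
        ≡⟨ 𝟙-cong ((words? ×-dec b-returns?) ×-dec a-returns?) cycles? to from ⟩
      𝟙 cycles?
        ≡⟨ 𝟙-× (onCycle? f a m) (b ∉? toList ox ×-dec onCycle? f b m′) cycles? ⟩
      𝟙 (onCycle? f a m) * 𝟙 (b ∉? toList ox ×-dec onCycle? f b m′)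
        ≡⟨ cong (𝟙 (onCycle? f a m) *_) (𝟙-× (b ∉? toList ox) (onCycle? f b m′) (b ∉? toList ox ×-dec onCycle? f b m′)) ⟩
      otherCycles v m m′ ∎
      where
      open ≡-Reasoning
      f = lookup v
      ox = orbit f a m
      oy = orbit f b m′
      a-returns? = iter f (suc m) a Fin.≟ a
      b-returns? = iter f (suc m′) b Fin.≟ b
      words? = unique? (toList oy ++ b ∷ toList ox ++ a ∷ [])
      cycles? = onCycle? f a m ×-dec (b ∉? toList ox ×-dec onCycle? f b m′)
      to : (Unique (toList oy ++ b ∷ toList ox ++ a ∷ []) × iter f (suc m′) b ≡ b) × iter f (suc m) a ≡ a →
           OnCycle f a m × b ∉ toList ox × OnCycle f b m′
      to ((uniq , b-returns) , a-returns) with Unique-split (toList oy) (toList ox ++ a ∷ []) uniq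
      ... | b-unique , b∉ , a-unique = (a-unique , a-returns) , b∉ ∘ ∈-++⁺ˡ , (b-unique , b-returns)
      from : OnCycle f a m × b ∉ toList ox × OnCycle f b m′ →
             (Unique (toList oy ++ b ∷ toList ox ++ a ∷ []) × iter f (suc m′) b ≡ b) × iter f (suc m) a ≡ a
      from (a-cycle , b∉ , b-cycle) = (disjoint-cycles f a-cycle b-cycle (b∉[a] (toList ox) b∉) , proj₂ b-cycle) , proj₂ a-cycle

    otherCycles-as-paths : ∀ v →
      ∑ (allVecs (2 + N) m) (λ x → ∑ (allVecs (2 + N) m′) (λ y → twoCycleWords x y * 𝟙 (satisfies? v (path a x a ++ path b y b))))
        ≡ otherCycles v m m′
    otherCycles-as-paths v = begin
      ∑ (allVecs (2 + N) m) (λ x → ∑ (allVecs (2 + N) m′) (λ y → twoCycleWords x y * 𝟙 (satisfies? v (path a x a ++ path b y b))))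
        ≡⟨ ∑-cong (allVecs (2 + N) m) (λ x → ∑-cong (allVecs (2 + N) m′) (λ y →
             trans (cong (twoCycleWords x y *_) (𝟙-satisfies-++ v (path a x a) (path b y b)))
                   (*-CS.x∙yz≈y∙xz (twoCycleWords x y) (𝟙 (satisfies? v (path a x a))) _))) ⟩
      ∑ (allVecs (2 + N) m) (λ x → ∑ (allVecs (2 + N) m′) (λ y → 𝟙 (satisfies? v (path a x a)) * (twoCycleWords x y * 𝟙 (satisfies? v (path b y b)))))
        ≡⟨ ∑-cong (allVecs (2 + N) m) (λ x → trans (∑-*ˡ (allVecs (2 + N) m′) (𝟙 (satisfies? v (path a x a)))
                                                        (λ y → twoCycleWords x y * 𝟙 (satisfies? v (path b y b))))
             (trans (cong (𝟙 (satisfies? v (path a x a)) *_) (∑-path v b m′ b (twoCycleWords x)))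
                    (*-comm (𝟙 (satisfies? v (path a x a))) _))) ⟩
      ∑ (allVecs (2 + N) m) (λ x → twoCycleWords x oy * 𝟙 (iter f (suc m′) b Fin.≟ b) * 𝟙 (satisfies? v (path a x a)))
        ≡⟨ ∑-path v a m a (λ x → twoCycleWords x oy * 𝟙 (iter f (suc m′) b Fin.≟ b)) ⟩
      twoCycleWords (orbit f a m) oy * 𝟙 (iter f (suc m′) b Fin.≟ b) * 𝟙 (iter f (suc m) a Fin.≟ a)
        ≡⟨ 𝟙-otherCycles v ⟩
      otherCycles v m m′ ∎
      where
      open ≡-Reasoning
      f = lookup v
      oy = orbit f b m′

    #twoCycleWords : m + m′ ≤ N →
      ∑ (allVecs (2 + N) m) (λ x → ∑ (allVecs (2 + N) m′) (twoCycleWords x)) ≡ (N P′ m) * ((N ∸ m) P′ m′)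
    #twoCycleWords m+m′≤N = begin
      ∑ (allVecs (2 + N) m) (λ x → ∑ (allVecs (2 + N) m′) (twoCycleWords x))
        ≡⟨ ∑-cong (allVecs (2 + N) m) (λ x → trans (#unique-prefixes (b ∷ toList x ++ a ∷ []) m′)
             (cong (λ k → 𝟙 (unique? (b ∷ toList x ++ a ∷ [])) * ((2 + N ∸ k) P′ m′)) (length-b∷x∷ʳa x))) ⟩
      ∑ (allVecs (2 + N) m) (λ x → 𝟙 (unique? (b ∷ toList x ++ a ∷ [])) * ((N ∸ m) P′ m′))
        ≡⟨ ∑-*ʳ (allVecs (2 + N) m) _ _ ⟩
      ∑ (allVecs (2 + N) m) (λ x → 𝟙 (unique? (b ∷ toList x ++ a ∷ []))) * ((N ∸ m) P′ m′)
        ≡⟨ cong (_* ((N ∸ m) P′ m′)) (begin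
             ∑ (allVecs (2 + N) m) (λ x → 𝟙 (unique? (b ∷ toList x ++ a ∷ [])))
               ≡⟨ ∑-cong (allVecs (2 + N) m) (λ x → 𝟙-cong (unique? (b ∷ toList x ++ a ∷ [])) (unique? (toList x ++ b ∷ a ∷ []))
                    (Unique-unshift (toList x) (a ∷ [])) (Unique-shift (toList x) (a ∷ []))) ⟩
             ∑ (allVecs (2 + N) m) (λ x → 𝟙 (unique? (toList x ++ b ∷ a ∷ [])))
               ≡⟨ #unique-prefixes (b ∷ a ∷ []) m ⟩
             𝟙 (unique? (b ∷ a ∷ [])) * (N P′ m)
               ≡⟨ trans (cong (_* (N P′ m)) unique-ba) (*-identityˡ (N P′ m)) ⟩
             N P′ m ∎) ⟩
      (N P′ m) * ((N ∸ m) P′ m′) ∎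
      where
      open ≡-Reasoning
      length-b∷x∷ʳa : ∀ x → length (b ∷ toList x ++ a ∷ []) ≡ suc (suc m)
      length-b∷x∷ʳa x = cong suc (trans (length-++ (toList x)) (trans (cong (_+ 1) (length-toList x)) (+-comm m 1)))

    #otherCycles : m + m′ ≤ N → ∑Perm (2 + N) (λ v → otherCycles v m m′) ≡ N !
    #otherCycles m+m′≤N = begin
      ∑Perm (2 + N) (λ v → otherCycles v m m′)
        ≡⟨ ∑Perm-cong (2 + N) (λ v _ → sym (otherCycles-as-paths v)) ⟩
      ∑Perm (2 + N) (λ v → ∑ (allVecs (2 + N) m) (λ x → ∑ (allVecs (2 + N) m′) (λ y → paths v x y)))
        ≡⟨ ∑Perm-comm (2 + N) (allVecs (2 + N) m) _ ⟩
      ∑ (allVecs (2 + N) m) (λ x → ∑Perm (2 + N) (λ v → ∑ (allVecs (2 + N) m′) (λ y → paths v x y)))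
        ≡⟨ ∑-cong (allVecs (2 + N) m) (λ x → ∑Perm-comm (2 + N) (allVecs (2 + N) m′) (λ v y → paths v x y)) ⟩
      ∑ (allVecs (2 + N) m) (λ x → ∑ (allVecs (2 + N) m′) (λ y → ∑Perm (2 + N) (λ v → paths v x y)))
        ≡⟨ ∑-cong (allVecs (2 + N) m) (λ x → ∑-cong (allVecs (2 + N) m′) (λ y → trans
             (∑Perm-*ˡ (2 + N) (twoCycleWords x y) (λ v → 𝟙 (satisfies? v (path a x a ++ path b y b))))
             (𝟙*-cong (unique? (toList y ++ b ∷ toList x ++ a ∷ [])) (#Sat-two-cycles x y)))) ⟩
      ∑ (allVecs (2 + N) m) (λ x → ∑ (allVecs (2 + N) m′) (λ y → twoCycleWords x y * (N ∸ m ∸ m′) !))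
        ≡⟨ ∑-cong (allVecs (2 + N) m) (λ x → ∑-*ʳ (allVecs (2 + N) m′) _ (twoCycleWords x)) ⟩
      ∑ (allVecs (2 + N) m) (λ x → ∑ (allVecs (2 + N) m′) (twoCycleWords x) * (N ∸ m ∸ m′) !)
        ≡⟨ ∑-*ʳ (allVecs (2 + N) m) _ _ ⟩
      ∑ (allVecs (2 + N) m) (λ x → ∑ (allVecs (2 + N) m′) (twoCycleWords x)) * (N ∸ m ∸ m′) !
        ≡⟨ cong (_* (N ∸ m ∸ m′) !) (#twoCycleWords m+m′≤N) ⟩
      (N P′ m) * ((N ∸ m) P′ m′) * (N ∸ m ∸ m′) !
        ≡⟨ *-assoc (N P′ m) _ _ ⟩
      (N P′ m) * (((N ∸ m) P′ m′) * (N ∸ m ∸ m′) !)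
        ≡⟨ cong ((N P′ m) *_) (nP′k*[n∸k]!≡n! (N ∸ m) m′ (m+n≤o⇒m≤o∸n m′ (subst (_≤ N) (+-comm m m′) m+m′≤N))) ⟩
      (N P′ m) * (N ∸ m) !
        ≡⟨ nP′k*[n∸k]!≡n! N m (≤-trans (m≤m+n m m′) m+m′≤N) ⟩
      N ! ∎
      where
      open ≡-Reasoning
      paths : Vec (Fin (2 + N)) (2 + N) → Vec (Fin (2 + N)) m → Vec (Fin (2 + N)) m′ → ℕ
      paths v x y = twoCycleWords x y * 𝟙 (satisfies? v (path a x a ++ path b y b))
      length-paths : ∀ x y → length (path a x a ++ path b y b) ≡ suc m + suc m′
      length-paths x y = trans (length-++ (path a x a)) (cong₂ _+_ (length-path a x a) (length-path b y b))
      #Sat-two-cycles : ∀ x y → Unique (toList y ++ b ∷ toList x ++ a ∷ []) → #Sat (path a x a ++ path b y b) ≡ (N ∸ m ∸ m′) !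
      #Sat-two-cycles x y uniq = begin
        #Sat (path a x a ++ path b y b)         ≡⟨ #Sat-valid _ (two-cycles-valid x y uniq) (subst (_≤ 2 + N) (sym (length-paths x y)) fits) ⟩
        (2 + N ∸ length (path a x a ++ path b y b)) ! ≡⟨ cong (λ k → (2 + N ∸ k) !) (length-paths x y) ⟩
        (suc N ∸ (m + suc m′)) !                ≡⟨ cong (λ k → (suc N ∸ k) !) (+-suc m m′) ⟩
        (N ∸ (m + m′)) !                        ≡⟨ cong _! (sym (∸-+-assoc N m m′)) ⟩
        (N ∸ m ∸ m′) !                          ∎
        where
        fits : suc m + suc m′ ≤ 2 + N
        fits = subst (_≤ 2 + N) (sym (cong suc (+-suc m m′))) (s≤s (s≤s m+m′≤N))

  module _ (k : ℕ) where

    𝟙-both-fixed-on-cycle : ∀ v → IsPermutation v → ∀ m → suc m ∣ suc k →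
      𝟙 (onCycle? (lookup v) a m) * 𝟙 (iter (lookup v) (suc k) b Fin.≟ b)
        ≡ sameCycle v m + ∑ (upTo (suc k)) (λ m′ → 𝟙 (suc m′ ∣? suc k) * otherCycles v m m′)
    𝟙-both-fixed-on-cycle v inj m m+1∣ = trans
      (𝟙-split (onCycle? f a m) (b ∈? o) (b ∉? o) (𝟙 (iter f (suc k) b Fin.≟ b)) (∑ (upTo (suc k)) b-cycle)
               (λ cycle b∈ → 𝟙-yes (iter f (suc k) b Fin.≟ b) (orbit-fixed f cycle m+1∣ b∈))
               (𝟙-iter-fixed f inj b k))
      (cong (sameCycle v m +_) (begin
        𝟙 (onCycle? f a m) * (𝟙 (b ∉? o) * ∑ (upTo (suc k)) b-cycle)
          ≡⟨ cong (𝟙 (onCycle? f a m) *_) (sym (∑-*ˡ (upTo (suc k)) (𝟙 (b ∉? o)) b-cycle)) ⟩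
        𝟙 (onCycle? f a m) * ∑ (upTo (suc k)) (λ m′ → 𝟙 (b ∉? o) * b-cycle m′)
          ≡⟨ sym (∑-*ˡ (upTo (suc k)) (𝟙 (onCycle? f a m)) (λ m′ → 𝟙 (b ∉? o) * b-cycle m′)) ⟩
        ∑ (upTo (suc k)) (λ m′ → 𝟙 (onCycle? f a m) * (𝟙 (b ∉? o) * b-cycle m′))
          ≡⟨ ∑-cong (upTo (suc k)) (λ m′ → reorder (𝟙 (onCycle? f a m)) (𝟙 (b ∉? o)) (𝟙 (suc m′ ∣? suc k)) (𝟙 (onCycle? f b m′))) ⟩
        ∑ (upTo (suc k)) (λ m′ → 𝟙 (suc m′ ∣? suc k) * otherCycles v m m′) ∎))
      where
      open ≡-Reasoning
      f = lookup v
      o = toList (orbit f a m)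
      b-cycle : ℕ → ℕ
      b-cycle m′ = 𝟙 (suc m′ ∣? suc k) * 𝟙 (onCycle? f b m′)
      reorder : ∀ x y z w → x * (y * (z * w)) ≡ z * (x * (y * w))
      reorder = solve-∀

    𝟙-both-fixed : ∀ v → IsPermutation v →
      𝟙 (iter (lookup v) (suc k) a Fin.≟ a) * 𝟙 (iter (lookup v) (suc k) b Fin.≟ b)
        ≡ ∑ (upTo (suc k)) (λ m → 𝟙 (suc m ∣? suc k) * (sameCycle v m + ∑ (upTo (suc k)) (λ m′ → 𝟙 (suc m′ ∣? suc k) * otherCycles v m m′)))
    𝟙-both-fixed v inj = begin
      𝟙 (iter f (suc k) a Fin.≟ a) * X
        ≡⟨ cong (_* X) (𝟙-iter-fixed f inj a k) ⟩
      ∑ (upTo (suc k)) (λ m → 𝟙 (suc m ∣? suc k) * 𝟙 (onCycle? f a m)) * X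
        ≡⟨ sym (∑-*ʳ (upTo (suc k)) X (λ m → 𝟙 (suc m ∣? suc k) * 𝟙 (onCycle? f a m))) ⟩
      ∑ (upTo (suc k)) (λ m → 𝟙 (suc m ∣? suc k) * 𝟙 (onCycle? f a m) * X)
        ≡⟨ ∑-cong (upTo (suc k)) (λ m → trans (*-assoc (𝟙 (suc m ∣? suc k)) _ X)
             (𝟙*-cong (suc m ∣? suc k) (𝟙-both-fixed-on-cycle v inj m))) ⟩
      ∑ (upTo (suc k)) (λ m → 𝟙 (suc m ∣? suc k) * (sameCycle v m + ∑ (upTo (suc k)) (λ m′ → 𝟙 (suc m′ ∣? suc k) * otherCycles v m m′))) ∎
      where
      open ≡-Reasoning
      f = lookup v
      X = 𝟙 (iter f (suc k) b Fin.≟ b)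

    #both-fixed : suc k + suc k ≤ 2 + N →
      ∑Perm (2 + N) (λ v → 𝟙 (iter (lookup v) (suc k) a Fin.≟ a) * 𝟙 (iter (lookup v) (suc k) b Fin.≟ b)) + N ! * τ (suc k)
        ≡ N ! * (σ (suc k) + τ (suc k) * τ (suc k))
    #both-fixed 2K≤n = begin
      ∑Perm (2 + N) (λ v → 𝟙 (iter (lookup v) K a Fin.≟ a) * 𝟙 (iter (lookup v) K b Fin.≟ b)) + N ! * τ K
        ≡⟨ cong₂ _+_ (trans (∑Perm-cong (2 + N) 𝟙-both-fixed) (∑Perm-comm (2 + N) (upTo K)
                       (λ v m → D m * (sameCycle v m + ∑ (upTo K) (λ m′ → D m′ * otherCycles v m m′)))))
                     (trans (cong (N ! *_) (τ≡∑ K)) (trans (sym (∑-*ˡ (upTo K) (N !) D)) (∑-cong (upTo K) (λ m → *-comm (N !) (D m))))) ⟩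
      ∑ (upTo K) (λ m → ∑Perm (2 + N) (λ v → D m * (sameCycle v m + ∑ (upTo K) (λ m′ → D m′ * otherCycles v m m′))))
        + ∑ (upTo K) (λ m → D m * N !)
        ≡⟨ cong (_+ ∑ (upTo K) (λ m → D m * N !))
             (∑-cong (upTo K) (λ m → trans (∑Perm-*ˡ (2 + N) (D m) _) (𝟙*-cong (suc m ∣? K) (per-cycle-length m)))) ⟩
      ∑ (upTo K) (λ m → D m * (m * N ! + τ K * N !)) + ∑ (upTo K) (λ m → D m * N !)
        ≡⟨ sym (∑-+ (upTo K) (λ m → D m * (m * N ! + τ K * N !)) (λ m → D m * N !)) ⟩
      ∑ (upTo K) (λ m → D m * (m * N ! + τ K * N !) + D m * N !)
        ≡⟨ ∑-cong (upTo K) (λ m → regroup (D m) m (N !) (τ K)) ⟩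
      ∑ (upTo K) (λ m → (D m * suc m + D m * τ K) * N !)
        ≡⟨ ∑-*ʳ (upTo K) (N !) (λ m → D m * suc m + D m * τ K) ⟩
      ∑ (upTo K) (λ m → D m * suc m + D m * τ K) * N !
        ≡⟨ cong (_* N !) (trans (∑-+ (upTo K) (λ m → D m * suc m) (λ m → D m * τ K))
             (cong₂ _+_ (sym (σ≡∑ K)) (trans (∑-*ʳ (upTo K) (τ K) D) (cong (_* τ K) (sym (τ≡∑ K)))))) ⟩
      (σ K + τ K * τ K) * N !
        ≡⟨ *-comm _ (N !) ⟩
      N ! * (σ K + τ K * τ K) ∎
      where
      open ≡-Reasoning
      K = suc k
      D : ℕ → ℕ
      D m = 𝟙 (suc m ∣? K)
      regroup : ∀ d m F t → d * (m * F + t * F) + d * F ≡ (d * suc m + d * t) * F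
      regroup = solve-∀
      fits : ∀ {m m′} → suc m ∣ K → suc m′ ∣ K → m + m′ ≤ N
      fits {m} {m′} m+1∣ m′+1∣ =
        ≤-pred (≤-pred (subst (_≤ 2 + N) (cong suc (+-suc m m′)) (≤-trans (+-mono-≤ (∣⇒≤ m+1∣) (∣⇒≤ m′+1∣)) 2K≤n)))
      per-cycle-length : ∀ m → suc m ∣ K →
        ∑Perm (2 + N) (λ v → sameCycle v m + ∑ (upTo K) (λ m′ → D m′ * otherCycles v m m′)) ≡ m * N ! + τ K * N !
      per-cycle-length m m+1∣ = trans (∑Perm-+ (2 + N) _ _) (cong₂ _+_
        (#sameCycle m (≤-trans (m≤m+n m m) (fits m+1∣ m+1∣)))
        (trans (∑Perm-comm (2 + N) (upTo K) _) (trans (∑-cong (upTo K) (λ m′ → ∑Perm-*ˡ (2 + N) (D m′) _))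
          (∑-divisors-const K _ (λ m′ m′+1∣ → #otherCycles m m′ (fits m+1∣ m′+1∣))))))

-- Conjugating by a transposition that fixes `a` shows that `swaps b` does not depend on `b ≢ a`;
-- summing over `b` counts the permutations whose K-th power moves `a` while their 2K-th power fixes it.
module Swaps {N : ℕ} (a : Fin (2 + N)) (k : ℕ) where

  private
    πᴷ : Vec (Fin (2 + N)) (2 + N) → Fin (2 + N) → Fin (2 + N)
    πᴷ v = iter (lookup v) (suc k)

  swaps : Fin (2 + N) → ℕ
  swaps b = ∑Perm (2 + N) (λ v → 𝟙 (πᴷ v a Fin.≟ b) * 𝟙 (πᴷ v b Fin.≟ a))

  swaps-invariant : ∀ {b b′} → b ≢ a → b′ ≢ a → swaps b′ ≡ swaps b
  swaps-invariant {b} {b′} b≢a b′≢a = sym (trans (∑Perm-cong (2 + N) (λ v _ → relabel v))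
    (∑Perm-compose t t t-inv t-inv (λ v → 𝟙 (πᴷ v a Fin.≟ b′) * 𝟙 (πᴷ v b′ Fin.≟ a))))
    where
    t = transpose b b′
    t-inv = transpose-involutive b b′
    t-fixes-a : t a ≡ a
    t-fixes-a = transpose-other b b′ (b≢a ∘ sym) (b′≢a ∘ sym)
    𝟙-t : ∀ x y → 𝟙 (t x Fin.≟ t y) ≡ 𝟙 (x Fin.≟ y)
    𝟙-t x y = 𝟙-cong (t x Fin.≟ t y) (x Fin.≟ y)
      (λ tx≡ty → trans (sym (t-inv x)) (trans (cong t tx≡ty) (t-inv y))) (cong t)
    relabel : ∀ v → 𝟙 (πᴷ v a Fin.≟ b) * 𝟙 (πᴷ v b Fin.≟ a) ≡ 𝟙 (πᴷ (compose t v t) a Fin.≟ b′) * 𝟙 (πᴷ (compose t v t) b′ Fin.≟ a)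
    relabel v = sym (cong₂ _*_
      (begin
        𝟙 (πᴷ (compose t v t) a Fin.≟ b′)  ≡⟨ cong (λ z → 𝟙 (z Fin.≟ b′)) (iter-conjugate t t-inv v (suc k) a) ⟩
        𝟙 (t (πᴷ v (t a)) Fin.≟ b′)        ≡⟨ cong₂ (λ z w → 𝟙 (t (πᴷ v z) Fin.≟ w)) t-fixes-a (sym (transpose-matchˡ b b′)) ⟩
        𝟙 (t (πᴷ v a) Fin.≟ t b)           ≡⟨ 𝟙-t (πᴷ v a) b ⟩
        𝟙 (πᴷ v a Fin.≟ b)                 ∎)
      (begin
        𝟙 (πᴷ (compose t v t) b′ Fin.≟ a)  ≡⟨ cong (λ z → 𝟙 (z Fin.≟ a)) (iter-conjugate t t-inv v (suc k) b′) ⟩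
        𝟙 (t (πᴷ v (t b′)) Fin.≟ a)        ≡⟨ cong₂ (λ z w → 𝟙 (t (πᴷ v z) Fin.≟ w)) (transpose-matchʳ b b′) (sym t-fixes-a) ⟩
        𝟙 (t (πᴷ v b) Fin.≟ t a)           ≡⟨ 𝟙-t (πᴷ v b) a ⟩
        𝟙 (πᴷ v b Fin.≟ a)                 ∎))
      where open ≡-Reasoning

  ∑-swaps : ∑ (allFin (2 + N)) (λ b → 𝟙 (b ∉? a ∷ []) * swaps b)
            ≡ ∑Perm (2 + N) (λ v → 𝟙 (πᴷ v a ∉? a ∷ []) * 𝟙 (πᴷ v (πᴷ v a) Fin.≟ a))
  ∑-swaps = begin
    ∑ (allFin (2 + N)) (λ b → 𝟙 (b ∉? a ∷ []) * swaps b)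
      ≡⟨ ∑-cong (allFin (2 + N)) (λ b → sym (∑Perm-*ˡ (2 + N) (𝟙 (b ∉? a ∷ [])) _)) ⟩
    ∑ (allFin (2 + N)) (λ b → ∑Perm (2 + N) (λ v → 𝟙 (b ∉? a ∷ []) * (𝟙 (πᴷ v a Fin.≟ b) * 𝟙 (πᴷ v b Fin.≟ a))))
      ≡⟨ sym (∑Perm-comm (2 + N) (allFin (2 + N)) _) ⟩
    ∑Perm (2 + N) (λ v → ∑ (allFin (2 + N)) (λ b → 𝟙 (b ∉? a ∷ []) * (𝟙 (πᴷ v a Fin.≟ b) * 𝟙 (πᴷ v b Fin.≟ a))))
      ≡⟨ ∑Perm-cong (2 + N) (λ v _ → trans
           (∑-cong (allFin (2 + N)) (λ b → *-CS.x∙yz≈y∙xz (𝟙 (b ∉? a ∷ [])) (𝟙 (πᴷ v a Fin.≟ b)) _))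
           (OverFin.∑-δ′ (πᴷ v a) (λ b → 𝟙 (b ∉? a ∷ []) * 𝟙 (πᴷ v b Fin.≟ a)))) ⟩
    ∑Perm (2 + N) (λ v → 𝟙 (πᴷ v a ∉? a ∷ []) * 𝟙 (πᴷ v (πᴷ v a) Fin.≟ a)) ∎
    where open ≡-Reasoning

  #swaps : ∀ {b} → b ≢ a → suc k + suc k ≤ 2 + N → τ (suc k + suc k) * suc N ! ≡ τ (suc k) * suc N ! + suc N * swaps b
  #swaps {b} b≢a 2K≤n = begin
    τ (suc k + suc k) * suc N !
      ≡⟨ sym (#power-fixes a (k + suc k) 2K≤n) ⟩
    ∑Perm (2 + N) (λ v → 𝟙 (iter (lookup v) (suc k + suc k) a Fin.≟ a))
      ≡⟨ ∑Perm-cong (2 + N) (λ v _ → split v) ⟩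
    ∑Perm (2 + N) (λ v → 𝟙 (πᴷ v a Fin.≟ a) + 𝟙 (πᴷ v a ∉? a ∷ []) * 𝟙 (πᴷ v (πᴷ v a) Fin.≟ a))
      ≡⟨ ∑Perm-+ (2 + N) _ _ ⟩
    ∑Perm (2 + N) (λ v → 𝟙 (πᴷ v a Fin.≟ a)) + ∑Perm (2 + N) (λ v → 𝟙 (πᴷ v a ∉? a ∷ []) * 𝟙 (πᴷ v (πᴷ v a) Fin.≟ a))
      ≡⟨ cong₂ _+_ (#power-fixes a k (≤-trans (m≤m+n (suc k) (suc k)) 2K≤n)) (sym ∑-swaps) ⟩
    τ (suc k) * suc N ! + ∑ (allFin (2 + N)) (λ b′ → 𝟙 (b′ ∉? a ∷ []) * swaps b′)
      ≡⟨ cong (τ (suc k) * suc N ! +_) all-equal ⟩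
    τ (suc k) * suc N ! + suc N * swaps b ∎
    where
    open ≡-Reasoning
    split : ∀ v → 𝟙 (iter (lookup v) (suc k + suc k) a Fin.≟ a)
                  ≡ 𝟙 (πᴷ v a Fin.≟ a) + 𝟙 (πᴷ v a ∉? a ∷ []) * 𝟙 (πᴷ v (πᴷ v a) Fin.≟ a)
    split v = trans (cong (λ z → 𝟙 (z Fin.≟ a)) (iter-+ (lookup v) (suc k) (suc k) a))
                    (cases (πᴷ v a Fin.≟ a) (πᴷ v a ∉? a ∷ []))
      where
      X = 𝟙 (πᴷ v (πᴷ v a) Fin.≟ a)
      cases : (d : Dec (πᴷ v a ≡ a)) (e : Dec (πᴷ v a ∉ a ∷ [])) → X ≡ 𝟙 d + 𝟙 e * X
      cases (yes fixed) e = trans (𝟙-yes (πᴷ v (πᴷ v a) Fin.≟ a) (trans (cong (πᴷ v) fixed) fixed))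
                                  (cong (λ c → 1 + c * X) (sym (𝟙-no e (λ ∉ → ∉ (here fixed)))))
      cases (no moved)  e = sym (trans (cong (_* X) (𝟙-yes e (λ { (here fixed) → moved fixed }))) (+-identityʳ X))
    all-equal : ∑ (allFin (2 + N)) (λ b′ → 𝟙 (b′ ∉? a ∷ []) * swaps b′) ≡ suc N * swaps b
    all-equal = begin
      ∑ (allFin (2 + N)) (λ b′ → 𝟙 (b′ ∉? a ∷ []) * swaps b′)
        ≡⟨ ∑-cong (allFin (2 + N)) (λ b′ → 𝟙*-cong (b′ ∉? a ∷ []) (λ b′∉ → swaps-invariant b≢a (b′∉ ∘ here))) ⟩
      ∑ (allFin (2 + N)) (λ b′ → 𝟙 (b′ ∉? a ∷ []) * swaps b)
        ≡⟨ ∑-*ʳ (allFin (2 + N)) (swaps b) (λ b′ → 𝟙 (b′ ∉? a ∷ [])) ⟩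
      ∑ (allFin (2 + N)) (λ b′ → 𝟙 (b′ ∉? a ∷ [])) * swaps b
        ≡⟨ cong (_* swaps b) (#∉ (a ∷ []) ([] ∷ [])) ⟩
      suc N * swaps b ∎

-- Divisors of 2K

odd⇒∤ : ∀ d → d % 2 ≡ 1 → ¬ 2 ∣ d
odd⇒∤ d odd 2∣d = ℕ.0≢1+n (trans (sym (n∣m⇒m%n≡0 d 2 2∣d)) odd)

∤⇒odd : ∀ d → ¬ 2 ∣ d → d % 2 ≡ 1
∤⇒odd d 2∤d = remainder (d % 2) refl (m%n<n d 2)
  where
  remainder : ∀ r → d % 2 ≡ r → r < 2 → d % 2 ≡ 1
  remainder zero          d%2≡0 _ = ⊥-elim (2∤d (m%n≡0⇒n∣m d 2 d%2≡0))
  remainder (suc zero)    d%2≡1 _ = d%2≡1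
  remainder (suc (suc r)) _     (s≤s (s≤s ()))

-- Divisors `e` of 2K that do not divide K correspond to odd divisors `d` of K via d * e = 2K.
module DoubleDivisors (k : ℕ) where

  K = suc k

  K+K≡K*2 : K + K ≡ K * 2
  K+K≡K*2 = trans (cong (K +_) (sym (+-identityʳ K))) (*-comm 2 K)

  Paired : ℕ → ℕ → Set
  Paired d e = d * e ≡ K + K × ¬ (e ∣ K)

  paired? : ∀ d e → Dec (Paired d e)
  paired? d e = (d * e ℕ.≟ K + K) ×-dec ¬? (e ∣? K)

  newDivisor? : ∀ e → Dec (e ∣ K + K × ¬ (e ∣ K))
  newDivisor? e = (e ∣? K + K) ×-dec ¬? (e ∣? K)

  oddDivisor? : ∀ d → Dec (d ∣ K × d % 2 ≡ 1)
  oddDivisor? d = (d ∣? K) ×-dec (d % 2 ℕ.≟ 1)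

  halve : ∀ x y → x * 2 * y ≡ K + K → x * y ≡ K
  halve x y eq = *-cancelʳ-≡ (x * y) K 2 (trans (*-CS.xy∙z≈xz∙y x y 2) (trans eq K+K≡K*2))

  paired⇒odd : ∀ {d e} → Paired d e → d ∣ K × d % 2 ≡ 1
  paired⇒odd {d} {e} (de≡2K , e∤K) = d∣K , ∤⇒odd d 2∤d
    where
    2∤d : ¬ 2 ∣ d
    2∤d (divides d′ refl) = e∤K (divides d′ (sym (halve d′ e de≡2K)))
    d∣K : d ∣ K
    d∣K with euclidsLemma d e (from-yes (prime? 2)) (divides K (trans de≡2K K+K≡K*2))
    ... | inj₁ 2∣d             = ⊥-elim (2∤d 2∣d)
    ... | inj₂ (divides e′ refl) = divides e′ (sym (halve e′ d (trans (*-comm (e′ * 2) d) de≡2K)))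

  𝟙-newDivisor : ∀ e → 𝟙 (newDivisor? (suc e)) ≡ ∑ (upTo K) (λ d → 𝟙 (paired? (suc d) (suc e)))
  𝟙-newDivisor e = count (newDivisor? (suc e))
    where
    count : (new? : Dec (suc e ∣ K + K × ¬ (suc e ∣ K))) → 𝟙 new? ≡ ∑ (upTo K) (λ d → 𝟙 (paired? (suc d) (suc e)))
    count (no ¬new) = sym (∑-upTo-none (λ d → paired? (suc d) (suc e)) K (λ d (eq , e∤K) → ¬new (divides (suc d) (sym eq) , e∤K)))
    count (yes (divides zero    eq , _))   = ⊥-elim (ℕ.1+n≢0 eq)
    count (yes (divides (suc q) eq , e∤K)) = sym (∑-upTo-unique (λ d → paired? (suc d) (suc e)) K q<K (sym eq , e∤K)
        (λ (eq′ , _) → suc-injective (*-cancelʳ-≡ _ (suc q) (suc e) (trans eq′ eq))))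
      where
      e≥2 : 2 ≤ suc e
      e≥2 = nontrivial e e∤K
        where
        nontrivial : ∀ e → ¬ suc e ∣ K → 2 ≤ suc e
        nontrivial zero    1∤K = ⊥-elim (1∤K (divides K (sym (*-identityʳ K))))
        nontrivial (suc _) _   = s≤s (s≤s z≤n)
      q<K : q < K
      q<K = *-cancelʳ-≤ (suc q) K 2 (≤-trans (*-monoʳ-≤ (suc q) e≥2) (subst (_≤ K * 2) eq (subst (K + K ≤_) K+K≡K*2 ≤-refl)))

  𝟙-oddDivisor : ∀ d → 𝟙 (oddDivisor? (suc d)) ≡ ∑ (upTo (K + K)) (λ e → 𝟙 (paired? (suc d) (suc e)))
  𝟙-oddDivisor d = count (oddDivisor? (suc d))
    where
    count : (odd? : Dec (suc d ∣ K × suc d % 2 ≡ 1)) → 𝟙 odd? ≡ ∑ (upTo (K + K)) (λ e → 𝟙 (paired? (suc d) (suc e)))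
    count (no ¬odd) = sym (∑-upTo-none (λ e → paired? (suc d) (suc e)) (K + K) (λ e → ¬odd ∘ paired⇒odd))
    count (yes (divides zero    eq , _))   = ⊥-elim (ℕ.1+n≢0 eq)
    count (yes (divides (suc c) eq , odd)) = sym (∑-upTo-unique (λ e → paired? (suc d) (suc e)) (K + K) bound (pairs , 2c∤K)
        (λ (eq′ , _) → suc-injective (*-cancelˡ-≡ _ (suc c + suc c) (suc d) (trans eq′ (sym pairs)))))
      where
      pairs : suc d * (suc c + suc c) ≡ K + K
      pairs = trans (*-distribˡ-+ (suc d) (suc c) (suc c))
                    (cong₂ _+_ (trans (*-comm (suc d) (suc c)) (sym eq)) (trans (*-comm (suc d) (suc c)) (sym eq)))
      2c∤K : ¬ (suc c + suc c) ∣ K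
      2c∤K (divides t K≡t*2c) = odd⇒∤ (suc d) odd (divides t (*-cancelˡ-≡ (suc d) (t * 2) (suc c) (begin
        suc c * suc d          ≡⟨ sym eq ⟩
        K                      ≡⟨ K≡t*2c ⟩
        t * (suc c + suc c)    ≡⟨ cong (t *_) (trans (cong (suc c +_) (sym (+-identityʳ (suc c)))) (*-comm 2 (suc c))) ⟩
        t * (suc c * 2)        ≡⟨ *-CS.x∙yz≈y∙xz t (suc c) 2 ⟩
        suc c * (t * 2)        ∎)))
        where open ≡-Reasoning
      bound : c + suc c < K + K
      bound = +-mono-≤ c<K c<K
        where
        c<K : suc c ≤ K
        c<K = ∣⇒≤ (divides (suc d) (trans eq (*-comm (suc c) (suc d))))

  τₒ≡∑ : τₒ K ≡ ∑ (upTo K) (λ d → 𝟙 (oddDivisor? (suc d)))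
  τₒ≡∑ = begin
    length (filter (λ d → d % 2 ℕ.≟ 1) (divisors K))
      ≡⟨ sym (trans (∑-const (filter (λ d → d % 2 ℕ.≟ 1) (divisors K)) 1) (*-identityʳ _)) ⟩
    ∑ (filter (λ d → d % 2 ℕ.≟ 1) (divisors K)) (const 1)
      ≡⟨ ∑-filter (λ d → d % 2 ℕ.≟ 1) (divisors K) (const 1) ⟩
    ∑ (divisors K) (λ d → 𝟙 (d % 2 ℕ.≟ 1) * 1)
      ≡⟨ ∑-filter (_∣? K) (map suc (upTo K)) (λ d → 𝟙 (d % 2 ℕ.≟ 1) * 1) ⟩
    ∑ (map suc (upTo K)) (λ d → 𝟙 (d ∣? K) * (𝟙 (d % 2 ℕ.≟ 1) * 1))
      ≡⟨ ∑-map suc (upTo K) (λ d → 𝟙 (d ∣? K) * (𝟙 (d % 2 ℕ.≟ 1) * 1)) ⟩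
    ∑ (upTo K) (λ d → 𝟙 (suc d ∣? K) * (𝟙 (suc d % 2 ℕ.≟ 1) * 1))
      ≡⟨ ∑-cong (upTo K) (λ d → trans (cong (𝟙 (suc d ∣? K) *_) (*-identityʳ _)) (sym (𝟙-× (suc d ∣? K) (suc d % 2 ℕ.≟ 1) (oddDivisor? (suc d))))) ⟩
    ∑ (upTo K) (λ d → 𝟙 (oddDivisor? (suc d))) ∎
    where open ≡-Reasoning

  τ-double : τ (K + K) ≡ τ K + τₒ K
  τ-double = begin
    τ (K + K)
      ≡⟨ τ≡∑ (K + K) ⟩
    ∑ (upTo (K + K)) (λ e → 𝟙 (suc e ∣? K + K))
      ≡⟨ ∑-cong (upTo (K + K)) (λ e → split (suc e)) ⟩
    ∑ (upTo (K + K)) (λ e → 𝟙 (suc e ∣? K) + 𝟙 (newDivisor? (suc e)))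
      ≡⟨ ∑-+ (upTo (K + K)) (λ e → 𝟙 (suc e ∣? K)) (λ e → 𝟙 (newDivisor? (suc e))) ⟩
    ∑ (upTo (K + K)) (λ e → 𝟙 (suc e ∣? K)) + ∑ (upTo (K + K)) (λ e → 𝟙 (newDivisor? (suc e)))
      ≡⟨ cong₂ _+_ (sym (τ≡∑-beyond k K)) (∑-cong (upTo (K + K)) 𝟙-newDivisor) ⟩
    τ K + ∑ (upTo (K + K)) (λ e → ∑ (upTo K) (λ d → 𝟙 (paired? (suc d) (suc e))))
      ≡⟨ cong (τ K +_) (∑-comm (upTo (K + K)) (upTo K) (λ e d → 𝟙 (paired? (suc d) (suc e)))) ⟩
    τ K + ∑ (upTo K) (λ d → ∑ (upTo (K + K)) (λ e → 𝟙 (paired? (suc d) (suc e))))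
      ≡⟨ cong (τ K +_) (trans (sym (∑-cong (upTo K) 𝟙-oddDivisor)) (sym τₒ≡∑)) ⟩
    τ K + τₒ K ∎
    where
    open ≡-Reasoning
    split : ∀ e → 𝟙 (e ∣? K + K) ≡ 𝟙 (e ∣? K) + 𝟙 (newDivisor? e)
    split e = cases (e ∣? K)
      where
      cases : (e∣?K : Dec (e ∣ K)) → 𝟙 (e ∣? K + K) ≡ 𝟙 e∣?K + 𝟙 (newDivisor? e)
      cases (yes (divides q eq)) = trans (𝟙-yes (e ∣? K + K) (divides (q + q) (trans (cong₂ _+_ eq eq) (sym (*-distribʳ-+ e q q)))))
                                         (cong suc (sym (𝟙-no (newDivisor? e) (λ (_ , e∤K) → e∤K (divides q eq)))))
      cases (no e∤K) = 𝟙-cong (e ∣? K + K) (newDivisor? e) (λ e∣2K → e∣2K , e∤K) proj₁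

-- Descents

module AdjacentTransposition {n : ℕ} {a b : Fin n} (b≡1+a : toℕ b ≡ suc (toℕ a)) where

  s : Fin n → Fin n
  s = transpose a b

  a<b : a <ᶠ b
  a<b = subst (toℕ a <_) (sym b≡1+a) ≤-refl

  a≢b : a ≢ b
  a≢b a≡b = Fin.<-irrefl a≡b a<b

  private
    above : ∀ {z} → z ≢ b → a <ᶠ z → b <ᶠ z
    above z≢b a<z = Fin.≤∧≢⇒< (subst (_≤ toℕ _) (sym b≡1+a) a<z) (z≢b ∘ sym)

    below : ∀ {z} → z ≢ a → z <ᶠ b → z <ᶠ a
    below z≢a z<b = Fin.≤∧≢⇒< (≤-pred (subst (_ <_) b≡1+a z<b)) z≢a

  s-cases : ∀ x → (x ≡ a × s x ≡ b) ⊎ (x ≡ b × s x ≡ a) ⊎ (x ≢ a × x ≢ b × s x ≡ x)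
  s-cases x = cases (x Fin.≟ a) (x Fin.≟ b)
    where
    cases : Dec (x ≡ a) → Dec (x ≡ b) → (x ≡ a × s x ≡ b) ⊎ (x ≡ b × s x ≡ a) ⊎ (x ≢ a × x ≢ b × s x ≡ x)
    cases (yes refl) _          = inj₁ (refl , transpose-matchˡ a b)
    cases (no  _)    (yes refl) = inj₂ (inj₁ (refl , transpose-matchʳ a b))
    cases (no  x≢a)  (no  x≢b)  = inj₂ (inj₂ (x≢a , x≢b , transpose-other a b x≢a x≢b))

  𝟙-s-< : ∀ {x y} → x ≢ y → ¬ (x ≡ a × y ≡ b) → ¬ (x ≡ b × y ≡ a) → 𝟙 (s x Fin.<? s y) ≡ 𝟙 (x Fin.<? y)
  𝟙-s-< {x} {y} x≢y ¬ab ¬ba with s-cases x | s-cases y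
  ... | inj₁ (refl , _)  | inj₁ (refl , _)  = ⊥-elim (x≢y refl)
  ... | inj₁ (refl , _)  | inj₂ (inj₁ (refl , _)) = ⊥-elim (¬ab (refl , refl))
  ... | inj₁ (refl , sx) | inj₂ (inj₂ (_ , y≢b , sy)) =
    trans (cong₂ (λ u w → 𝟙 (u Fin.<? w)) sx sy) (𝟙-cong (b Fin.<? y) (a Fin.<? y) (Fin.<-trans a<b) (above y≢b))
  ... | inj₂ (inj₁ (refl , _)) | inj₁ (refl , _) = ⊥-elim (¬ba (refl , refl))
  ... | inj₂ (inj₁ (refl , _)) | inj₂ (inj₁ (refl , _)) = ⊥-elim (x≢y refl)
  ... | inj₂ (inj₁ (refl , sx)) | inj₂ (inj₂ (_ , y≢b , sy)) =
    trans (cong₂ (λ u w → 𝟙 (u Fin.<? w)) sx sy) (𝟙-cong (a Fin.<? y) (b Fin.<? y) (above y≢b) (Fin.<-trans a<b))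
  ... | inj₂ (inj₂ (x≢a , _ , sx)) | inj₁ (refl , sy) =
    trans (cong₂ (λ u w → 𝟙 (u Fin.<? w)) sx sy) (𝟙-cong (x Fin.<? b) (x Fin.<? a) (below x≢a) (λ x<a → Fin.<-trans x<a a<b))
  ... | inj₂ (inj₂ (x≢a , _ , sx)) | inj₂ (inj₁ (refl , sy)) =
    trans (cong₂ (λ u w → 𝟙 (u Fin.<? w)) sx sy) (𝟙-cong (x Fin.<? a) (x Fin.<? b) (λ x<a → Fin.<-trans x<a a<b) (below x≢a))
  ... | inj₂ (inj₂ (_ , _ , sx)) | inj₂ (inj₂ (_ , _ , sy)) = cong₂ (λ u w → 𝟙 (u Fin.<? w)) sx sy

  𝟙-<-total : ∀ {x y : Fin n} → x ≢ y → 𝟙 (y Fin.<? x) + 𝟙 (x Fin.<? y) ≡ 1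
  𝟙-<-total {x} {y} x≢y with Fin.<-cmp x y
  ... | tri< x<y _ _ = cong₂ _+_ (𝟙-no (y Fin.<? x) (Fin.<-asym x<y)) (𝟙-yes (x Fin.<? y) x<y)
  ... | tri≈ _ x≡y _ = ⊥-elim (x≢y x≡y)
  ... | tri> _ _ y<x = cong₂ _+_ (𝟙-yes (y Fin.<? x) y<x) (𝟙-no (x Fin.<? y) (Fin.<-asym y<x))

  𝟙-descent-pair : ∀ {x y} → x ≢ y →
    𝟙 (y Fin.<? x) + 𝟙 (s x Fin.<? s y) + 𝟙 (x Fin.≟ a) * 𝟙 (y Fin.≟ b) ≡ 1 + 𝟙 (x Fin.≟ b) * 𝟙 (y Fin.≟ a)
  𝟙-descent-pair {x} {y} x≢y = begin
    𝟙 (y Fin.<? x) + 𝟙 (s x Fin.<? s y) + 𝟙 (x Fin.≟ a) * 𝟙 (y Fin.≟ b)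
      ≡⟨ cong (𝟙 (y Fin.<? x) + 𝟙 (s x Fin.<? s y) +_) (sym (𝟙-× (x Fin.≟ a) (y Fin.≟ b) ab?)) ⟩
    𝟙 (y Fin.<? x) + 𝟙 (s x Fin.<? s y) + 𝟙 ab?
      ≡⟨ cases ab? ba? ⟩
    1 + 𝟙 ba?
      ≡⟨ cong suc (𝟙-× (x Fin.≟ b) (y Fin.≟ a) ba?) ⟩
    1 + 𝟙 (x Fin.≟ b) * 𝟙 (y Fin.≟ a) ∎
    where
    open ≡-Reasoning
    ab? = x Fin.≟ a ×-dec y Fin.≟ b
    ba? = x Fin.≟ b ×-dec y Fin.≟ a
    cases : (p : Dec (x ≡ a × y ≡ b)) (q : Dec (x ≡ b × y ≡ a)) → 𝟙 (y Fin.<? x) + 𝟙 (s x Fin.<? s y) + 𝟙 p ≡ 1 + 𝟙 q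
    cases (yes (refl , refl)) q = begin
      𝟙 (b Fin.<? a) + 𝟙 (s a Fin.<? s b) + 1   ≡⟨ cong (λ c → 𝟙 (b Fin.<? a) + c + 1) (cong₂ (λ u w → 𝟙 (u Fin.<? w)) (transpose-matchˡ a b) (transpose-matchʳ a b)) ⟩
      𝟙 (b Fin.<? a) + 𝟙 (b Fin.<? a) + 1       ≡⟨ cong (λ c → c + c + 1) (𝟙-no (b Fin.<? a) (Fin.<-asym a<b)) ⟩
      1                                          ≡⟨ cong suc (sym (𝟙-no q (λ (a≡b , _) → a≢b a≡b))) ⟩
      1 + 𝟙 q                                    ∎
    cases (no _) (yes (refl , refl)) = begin
      𝟙 (a Fin.<? b) + 𝟙 (s b Fin.<? s a) + 0   ≡⟨ cong (λ c → 𝟙 (a Fin.<? b) + c + 0) (cong₂ (λ u w → 𝟙 (u Fin.<? w)) (transpose-matchʳ a b) (transpose-matchˡ a b)) ⟩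
      𝟙 (a Fin.<? b) + 𝟙 (a Fin.<? b) + 0       ≡⟨ cong (λ c → c + c + 0) (𝟙-yes (a Fin.<? b) a<b) ⟩
      2                                          ∎
    cases (no ¬ab) (no ¬ba) = begin
      𝟙 (y Fin.<? x) + 𝟙 (s x Fin.<? s y) + 0   ≡⟨ +-identityʳ _ ⟩
      𝟙 (y Fin.<? x) + 𝟙 (s x Fin.<? s y)       ≡⟨ cong (𝟙 (y Fin.<? x) +_) (𝟙-s-< x≢y ¬ab ¬ba) ⟩
      𝟙 (y Fin.<? x) + 𝟙 (x Fin.<? y)           ≡⟨ 𝟙-<-total x≢y ⟩
      1                                          ∎

desList-tabulate : ∀ {n} m (g : Fin (suc m) → Fin n) →
  desList (toList (tabulateᵥ g)) ≡ ∑ (allFin m) (λ i → 𝟙 (g (suc i) Fin.<? g (inject₁ i)))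
desList-tabulate zero    g = refl
desList-tabulate (suc m) g = trans (cong (𝟙 (g (suc zero) Fin.<? g zero) +_) (desList-tabulate m (g ∘ suc)))
                                   (sym (∑-allFin-suc m (λ i → 𝟙 (g (suc i) Fin.<? g (inject₁ i)))))

-- Except for the π whose K-th power fixes or swaps `a` and `b`, conjugation by (a b) exchanges descents and ascents at `a`.
module DescentsAt {N : ℕ} (i : Fin (suc N)) (k : ℕ) where

  a b : Fin (2 + N)
  a = inject₁ i
  b = suc i

  open AdjacentTransposition {a = a} {b = b} (cong suc (sym (Fin.toℕ-inject₁ i)))

  descents : ℕ
  descents = ∑Perm (2 + N) (λ v → 𝟙 (iter (lookup v) (suc k) b Fin.<? iter (lookup v) (suc k) a))

  descents-conjugate : descents ≡ ∑Perm (2 + N) (λ v → 𝟙 (s (iter (lookup v) (suc k) a) Fin.<? s (iter (lookup v) (suc k) b)))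
  descents-conjugate = trans (sym (∑Perm-compose s s s-inv s-inv (λ v → 𝟙 (iter (lookup v) (suc k) b Fin.<? iter (lookup v) (suc k) a))))
    (∑Perm-cong (2 + N) (λ v _ → cong₂ (λ u w → 𝟙 (u Fin.<? w))
      (trans (iter-conjugate s s-inv v (suc k) b) (cong (s ∘ iter (lookup v) (suc k)) (transpose-matchʳ a b)))
      (trans (iter-conjugate s s-inv v (suc k) a) (cong (s ∘ iter (lookup v) (suc k)) (transpose-matchˡ a b)))))
    where
    s-inv = transpose-involutive a b

  descents-identity :
    descents + descents + ∑Perm (2 + N) (λ v → 𝟙 (iter (lookup v) (suc k) a Fin.≟ a) * 𝟙 (iter (lookup v) (suc k) b Fin.≟ b))
      ≡ (2 + N) ! + Swaps.swaps a k b
  descents-identity = begin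
    descents + descents + ∑Perm (2 + N) (λ v → 𝟙 (x v Fin.≟ a) * 𝟙 (y v Fin.≟ b))
      ≡⟨ cong (λ D → descents + D + ∑Perm (2 + N) (λ v → 𝟙 (x v Fin.≟ a) * 𝟙 (y v Fin.≟ b))) descents-conjugate ⟩
    descents + ∑Perm (2 + N) (λ v → 𝟙 (s (x v) Fin.<? s (y v))) + ∑Perm (2 + N) (λ v → 𝟙 (x v Fin.≟ a) * 𝟙 (y v Fin.≟ b))
      ≡⟨ cong (_+ ∑Perm (2 + N) (λ v → 𝟙 (x v Fin.≟ a) * 𝟙 (y v Fin.≟ b))) (sym (∑Perm-+ (2 + N) _ _)) ⟩
    ∑Perm (2 + N) (λ v → 𝟙 (y v Fin.<? x v) + 𝟙 (s (x v) Fin.<? s (y v))) + ∑Perm (2 + N) (λ v → 𝟙 (x v Fin.≟ a) * 𝟙 (y v Fin.≟ b))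
      ≡⟨ sym (∑Perm-+ (2 + N) _ _) ⟩
    ∑Perm (2 + N) (λ v → 𝟙 (y v Fin.<? x v) + 𝟙 (s (x v) Fin.<? s (y v)) + 𝟙 (x v Fin.≟ a) * 𝟙 (y v Fin.≟ b))
      ≡⟨ ∑Perm-cong (2 + N) (λ v inj → 𝟙-descent-pair (a≢b ∘ iter-injective inj (suc k))) ⟩
    ∑Perm (2 + N) (λ v → 1 + 𝟙 (x v Fin.≟ b) * 𝟙 (y v Fin.≟ a))
      ≡⟨ trans (∑Perm-+ (2 + N) (const 1) _) (cong (_+ Swaps.swaps a k b) (#Perm {2 + N})) ⟩
    (2 + N) ! + Swaps.swaps a k b ∎
    where
    open ≡-Reasoning
    x y : Vec (Fin (2 + N)) (2 + N) → Fin (2 + N)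
    x v = iter (lookup v) (suc k) a
    y v = iter (lookup v) (suc k) b

  module _ (2K≤n : suc k + suc k ≤ 2 + N) where

    swaps≡τₒ*N! : Swaps.swaps a k b ≡ τₒ (suc k) * N !
    swaps≡τₒ*N! = sym (*-cancelˡ-≡ _ _ (suc N) (+-cancelˡ-≡ (τ (suc k) * suc N !) _ _ (begin
      τ (suc k) * suc N ! + suc N * (τₒ (suc k) * N !)    ≡⟨ cong (τ (suc k) * suc N ! +_) (*-CS.x∙yz≈y∙xz (suc N) (τₒ (suc k)) (N !)) ⟩
      τ (suc k) * suc N ! + τₒ (suc k) * suc N !          ≡⟨ sym (*-distribʳ-+ (suc N !) (τ (suc k)) _) ⟩
      (τ (suc k) + τₒ (suc k)) * suc N !                  ≡⟨ cong (_* suc N !) (sym (DoubleDivisors.τ-double k)) ⟩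
      τ (suc k + suc k) * suc N !                         ≡⟨ Swaps.#swaps a k (a≢b ∘ sym) 2K≤n ⟩
      τ (suc k) * suc N ! + suc N * Swaps.swaps a k b     ∎)))
      where open ≡-Reasoning

    position-identity : descents + descents + N ! * (σ (suc k) + τ (suc k) * τ (suc k))
                        ≡ (2 + N) ! + N ! * (τ (suc k) + τₒ (suc k))
    position-identity = begin
      descents + descents + N ! * (σ K + τ K * τ K)   ≡⟨ cong (descents + descents +_) (sym (TwoPoints.#both-fixed (a≢b ∘ sym) k 2K≤n)) ⟩
      descents + descents + (bothFixed + N ! * τ K)   ≡⟨ sym (+-assoc (descents + descents) bothFixed _) ⟩
      descents + descents + bothFixed + N ! * τ K     ≡⟨ cong (_+ N ! * τ K) descents-identity ⟩
      (2 + N) ! + Swaps.swaps a k b + N ! * τ K       ≡⟨ cong (λ c → (2 + N) ! + c + N ! * τ K) swaps≡τₒ*N! ⟩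
      (2 + N) ! + τₒ K * N ! + N ! * τ K              ≡⟨ +-assoc ((2 + N) !) _ _ ⟩
      (2 + N) ! + (τₒ K * N ! + N ! * τ K)            ≡⟨ cong ((2 + N) ! +_) (trans (+-comm (τₒ K * N !) _) (cong (N ! * τ K +_) (*-comm (τₒ K) (N !)))) ⟩
      (2 + N) ! + (N ! * τ K + N ! * τₒ K)            ≡⟨ cong ((2 + N) ! +_) (sym (*-distribˡ-+ (N !) (τ K) (τₒ K))) ⟩
      (2 + N) ! + N ! * (τ K + τₒ K)                  ∎
      where
      open ≡-Reasoning
      K = suc k
      bothFixed = ∑Perm (2 + N) (λ v → 𝟙 (iter (lookup v) K a Fin.≟ a) * 𝟙 (iter (lookup v) K b Fin.≟ b))

desPowSum≡∑descents : ∀ N k → desPowSum (2 + N) (suc k) ≡ ∑ (allFin (suc N)) (λ i → DescentsAt.descents i k)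
desPowSum≡∑descents N k = begin
  ∑ (Sym (2 + N)) (λ π → des (power π (suc k)))
    ≡⟨ ∑-Sym (2 + N) (λ π → des (power π (suc k))) ⟩
  ∑Perm (2 + N) (λ v → des (power v (suc k)))
    ≡⟨ ∑Perm-cong (2 + N) (λ v _ → desList-tabulate (suc N) (iter (lookup v) (suc k))) ⟩
  ∑Perm (2 + N) (λ v → ∑ (allFin (suc N)) (λ i → 𝟙 (iter (lookup v) (suc k) (suc i) Fin.<? iter (lookup v) (suc k) (inject₁ i))))
    ≡⟨ ∑Perm-comm (2 + N) (allFin (suc N)) _ ⟩
  ∑ (allFin (suc N)) (λ i → DescentsAt.descents i k) ∎
  where open ≡-Reasoning

descent-formula : ∀ N k → suc k + suc k ≤ 2 + N →
  2 * (2 + N) * desPowSum (2 + N) (suc k) + (2 + N) ! * (τ (suc k) * τ (suc k) + σ (suc k))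
    ≡ (2 + N) ! * ((2 + N) * suc N) + (2 + N) ! * (τ (suc k) + τₒ (suc k))
descent-formula N k 2K≤n = begin
  2 * (2 + N) * D + (2 + N) ! * (τ K * τ K + σ K)         ≡⟨ expand (2 + N) (suc N) D (N !) (τ K) (σ K) ⟩
  (2 + N) * (D + D + suc N * X)                           ≡⟨ cong ((2 + N) *_) summed ⟩
  (2 + N) * (suc N * Y)                                   ≡⟨ collect (2 + N) (suc N) (N !) (τ K + τₒ K) ⟩
  (2 + N) ! * ((2 + N) * suc N) + (2 + N) ! * (τ K + τₒ K) ∎
  where
  open ≡-Reasoning
  K = suc k
  D = desPowSum (2 + N) K
  X = N ! * (σ K + τ K * τ K)
  Y = (2 + N) ! + N ! * (τ K + τₒ K)
  expand : ∀ n m d f t s → 2 * n * d + n * (m * f) * (t * t + s) ≡ n * (d + d + m * (f * (s + t * t)))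
  expand = solve-∀
  collect : ∀ n m f c → n * (m * (n * (m * f) + f * c)) ≡ n * (m * f) * (n * m) + n * (m * f) * c
  collect = solve-∀
  summed : D + D + suc N * X ≡ suc N * Y
  summed = begin
    D + D + suc N * X
      ≡⟨ cong₂ (λ d c → d + d + c * X) (desPowSum≡∑descents N k) (sym (length-tabulate {n = suc N} id)) ⟩
    ∑ (allFin (suc N)) Dᵢ + ∑ (allFin (suc N)) Dᵢ + length (allFin (suc N)) * X
      ≡⟨ cong₂ _+_ (sym (∑-+ (allFin (suc N)) Dᵢ Dᵢ)) (sym (∑-const (allFin (suc N)) X)) ⟩
    ∑ (allFin (suc N)) (λ i → Dᵢ i + Dᵢ i) + ∑ (allFin (suc N)) (const X)
      ≡⟨ sym (∑-+ (allFin (suc N)) (λ i → Dᵢ i + Dᵢ i) (const X)) ⟩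
    ∑ (allFin (suc N)) (λ i → Dᵢ i + Dᵢ i + X)
      ≡⟨ ∑-cong (allFin (suc N)) (λ i → DescentsAt.position-identity i k 2K≤n) ⟩
    ∑ (allFin (suc N)) (const Y)
      ≡⟨ trans (∑-const (allFin (suc N)) Y) (cong (_* Y) (length-tabulate {n = suc N} id)) ⟩
    suc N * Y ∎
    where
    Dᵢ : Fin (suc N) → ℕ
    Dᵢ i = DescentsAt.descents i k

k+k≤n : ∀ k {n} → 2 * k + 1 ≤ n → k + k ≤ n
k+k≤n k 2k+1≤n = ≤-trans (subst (_≤ 2 * k + 1) (cong (k +_) (+-identityʳ k)) (m≤m+n (2 * k) 1)) 2k+1≤n

theorem1p1 : (k n : ℕ) → 1 ≤ k → 2 * k + 1 ≤ n →
    2 * n * desPowSum n k + (n !) * (τ k * τ k + σ k)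
    ≡ (n !) * (n * (n ∸ 1)) + (n !) * (τ k + τₒ k)
theorem1p1 zero    _             () _
theorem1p1 (suc k) zero          _  ()
theorem1p1 (suc k) (suc zero)    _  2K+1≤1 =
  ⊥-elim (ℕ.<-irrefl refl (≤-trans (+-mono-≤ (s≤s z≤n) (s≤s z≤n)) (k+k≤n (suc k) 2K+1≤1)))
theorem1p1 (suc k) (suc (suc N)) _  2K+1≤n = descent-formula N k (k+k≤n (suc k) 2K+1≤n)
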